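{- Let $(G,\gamma)$ be a colored-Laman circuit with $n$ vertices, $c$ connected components, $\mathbb{Z}^2$-rank $k$ and $m=2n+2k-2c$ edges, and let $\mathbf d$ be a direction assignment such that the linear system $\mathbf P(G,\gamma,\mathbf d)$ has rank $2n+2k-2c$. Then every solution $(\mathbf p,\mathbf L)$ of $\mathbf P(G,\gamma,\mathbf d)$ is collapsed.
   Context: A colored graph is a finite directed multigraph (parallel edges, self-loops allowed) with colors $\gamma_{ij}\in\mathbb{Z}^2$. For a simple cycle $C$ (self-loops count), $\rho(C)=\sum_{ij\text{ traversed }i\to j}\gamma_{ij}-\sum_{ij\text{ traversed }j\to i}\gamma_{ij}$; the $\mathbb{Z}^2$-rank $\mathrm{rk}$ is the rank of the subgroup they generate. Subgraphs are edge-induced with $n',m',c'$ vertices, edges, components. A colored graph is colored-Laman-sparse if every subgraph satisfies $m'\le 2n'-3+2\,\mathrm{rk}(G',\gamma)-2(c'-1)$; $(G,\gamma)$ is a colored-Laman circuit if $m=2n-2+2\,\mathrm{rk}(G,\gamma)-2(c-1)$ and removing any edge yields a colored-Laman-sparse graph. $\mathbf P(G,\gamma,\mathbf d)$ is the homogeneous linear system $\langle\mathbf p_j+\mathbf L\gamma_{ij}-\mathbf p_i,\mathbf d_{ij}^\perp\rangle=0$ for all edges $ij$ with unknowns $\mathbf p_i\in\mathbb{R}^2$, $\mathbf L\in\mathrm{Mat}_{2\times2}(\mathbb{R})$ ($\mathbf v^\perp$ = $\mathbf v$ rotated by $90^\circ$). A solution is collapsed if $\mathbf p_i=\mathbf p_j+\mathbf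 L\gamma_{ij}$ for every edge $ij$. -}

module Defs where

open import Level using (0ℓ)
open import Algebra.Bundles using (CommutativeRing)
open import Relation.Binary.Structures using (IsTotalOrder)
open import Data.Nat as ℕ using (ℕ; zero; suc)
open import Data.Integer as ℤ using (ℤ; +_; -[1+_])
open import Data.Fin as Fin using (Fin; zero; suc; inject₁; fromℕ; punchIn)
open import Data.Fin.Subset as Sub using (Subset; _∈_; ∣_∣; inside; outside)
open import Data.Vec using (tabulate; lookup)
open import Data.Bool using (Bool; true; false; if_then_else_; _∧_; _∨_)
open import Data.Product using (Σ; ∃; _×_; _,_; proj₁; proj₂)
open import Data.Sum using (_⊎_)
open import Data.Unit using () renaming (⊤ to Unit)
open import Relation.Nullary using (¬_)
open import Relation.Nullary.Decidable using (⌊_⌋)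
open import Relation.Binary.PropositionalEquality using (_≡_)
open import Function.Bundles using (_⇔_)

-- The real numbers, axiomatised as a complete ordered field (any model;
-- all models are isomorphic to ℝ).  Equality is the setoid equality _≈_.

record RealNumbers : Set₁ where
  field
    commRing : CommutativeRing 0ℓ 0ℓ
  open CommutativeRing commRing public
  field
    _≤ᵣ_ : Carrier → Carrier → Set
    0≉1 : ¬ (0# ≈ 1#)
    inverse : ∀ x → ¬ (x ≈ 0#) → ∃ λ y → (x * y) ≈ 1#
    ≤-isTotalOrder : IsTotalOrder _≈_ _≤ᵣ_
    +-mono-≤ : ∀ {x y} z → x ≤ᵣ y → (x + z) ≤ᵣ (y + z)
    *-nonneg : ∀ {x y} → 0# ≤ᵣ x → 0# ≤ᵣ y → 0# ≤ᵣ (x * y)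
    sup : (S : Carrier → Set) → ∃ S → (∃ λ b → ∀ x → S x → x ≤ᵣ b) →
          ∃ λ s → (∀ x → S x → x ≤ᵣ s) × (∀ b → (∀ x → S x → x ≤ᵣ b) → s ≤ᵣ b)

ℤ² : Set
ℤ² = ℤ × ℤ

_+²_ : ℤ² → ℤ² → ℤ²
(a , b) +² (c , d) = (a ℤ.+ c , b ℤ.+ d)

_·²_ : ℤ → ℤ² → ℤ²
k ·² (a , b) = (k ℤ.* a , k ℤ.* b)

-²_ : ℤ² → ℤ²
-² (a , b) = (ℤ.- a , ℤ.- b)

0² : ℤ²
0² = (+ 0 , + 0)

Σ² : ∀ {l} → (Fin l → ℤ²) → ℤ²
Σ² {zero} f = 0²
Σ² {suc l} f = f zero +² Σ² (λ i → f (suc i))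

record ColoredGraph (n m : ℕ) : Set where
  field
    src tgt : Fin m → Fin n
    col : Fin m → ℤ²
open ColoredGraph public

module _ {n m : ℕ} (G : ColoredGraph n m) where

  stepFrom stepTo : Fin m → Bool → Fin n
  stepFrom e true = src G e
  stepFrom e false = tgt G e
  stepTo e true = tgt G e
  stepTo e false = src G e

  stepColor : Fin m → Bool → ℤ²
  stepColor e true = col G e
  stepColor e false = -² col G e

  -- simple cycle (self-loops included) using only edges of S:
  -- steps 0..len, consecutive, closing up, distinct edges, distinct vertices
  record SimpleCycle (S : Subset m) : Set where
    field
      len : ℕ
      edge : Fin (suc len) → Fin m
      dir : Fin (suc len) → Bool
      inS : ∀ i → edge i ∈ S
      edge-inj : ∀ i j → edge i ≡ edge j → i ≡ j
      vertex-inj : ∀ i j → stepFrom (edge i) (dir i) ≡ stepFrom (edge j) (dir j) → i ≡ j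
      chain : ∀ (i : Fin len) →
        stepTo (edge (inject₁ i)) (dir (inject₁ i)) ≡ stepFrom (edge (suc i)) (dir (suc i))
      close : stepTo (edge (fromℕ len)) (dir (fromℕ len)) ≡ stepFrom (edge zero) (dir zero)

  ρ : ∀ {S} → SimpleCycle S → ℤ²
  ρ C = Σ² (λ i → stepColor (edge i) (dir i))
    where open SimpleCycle C

  InCycleSubgroup : Subset m → ℤ² → Set
  InCycleSubgroup S v = ∃ λ (l : ℕ) → Σ (Fin l → ℤ) λ a → Σ (Fin l → SimpleCycle S) λ cs →
    v ≡ Σ² (λ i → a i ·² ρ (cs i))

  Independent : ∀ {r} → (Fin r → ℤ²) → Set
  Independent {r} vs = ∀ (a : Fin r → ℤ) → Σ² (λ i → a i ·² vs i) ≡ 0² → ∀ i → a i ≡ + 0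

  -- rk(S, γ) = k : the rank of the generated subgroup (max. size of an
  -- independent family inside it) is k
  HasRank : Subset m → ℕ → Set
  HasRank S k =
    (∃ λ (vs : Fin k → ℤ²) → (∀ i → InCycleSubgroup S (vs i)) × Independent vs) ×
    (∀ (vs : Fin (suc k) → ℤ²) → (∀ i → InCycleSubgroup S (vs i)) → ¬ Independent vs)

  vertexSet : Subset m → Subset n
  vertexSet S = tabulate λ v → anyE (λ e → isIn (lookup S e) ∧
                  (⌊ src G e Fin.≟ v ⌋ ∨ ⌊ tgt G e Fin.≟ v ⌋))
    where
      isIn : Sub.Side → Bool
      isIn inside = true
      isIn outside = false
      anyE : ∀ {l} → (Fin l → Bool) → Bool
      anyE {zero} f = false
      anyE {suc l} f = f zero ∨ anyE (λ i → f (suc i))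

  data Walk (S : Subset m) : Fin n → Fin n → Set where
    []  : ∀ {v} → Walk S v v
    _∷_ : ∀ {u w} → (st : Σ (Fin m) λ e → Σ Bool λ b → e ∈ S × stepFrom e b ≡ u) →
          Walk S (stepTo (proj₁ st) (proj₁ (proj₂ st))) w → Walk S u w

  Connected : Subset m → Fin n → Fin n → Set
  Connected S u v = Walk S u v

  -- the graph with vertex set V and edge set S has exactly c connected
  -- components: a surjective labelling of V by Fin c whose fibres are
  -- exactly the connectivity classes
  NumComponents : Subset n → Subset m → ℕ → Set
  NumComponents V S c = Σ (∀ v → v ∈ V → Fin c) λ f →
    (∀ j → ∃ λ v → Σ (v ∈ V) λ h → f v h ≡ j) ×
    (∀ u (hu : u ∈ V) v (hv : v ∈ V) → (f u hu ≡ f v hv) ⇔ Connected S u v)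

ColoredLamanSparse : ∀ {n m} → ColoredGraph n m → Set
ColoredLamanSparse {n} {m} G = ∀ (S : Subset m) → Sub.Nonempty S → ∀ c' k' →
  NumComponents G (vertexSet G S) S c' → HasRank G S k' →
  (+ ∣ S ∣) ℤ.≤ ((+ 2) ℤ.* (+ ∣ vertexSet G S ∣) ℤ.- (+ 3) ℤ.+ (+ 2) ℤ.* (+ k')
                  ℤ.- (+ 2) ℤ.* ((+ c') ℤ.- (+ 1)))

removeEdge : ∀ {n m} → ColoredGraph n (suc m) → Fin (suc m) → ColoredGraph n m
removeEdge G e = record
  { src = λ i → src G (punchIn e i)
  ; tgt = λ i → tgt G (punchIn e i)
  ; col = λ i → col G (punchIn e i) }

AllEdgeDeletionsSparse : ∀ {n m} → ColoredGraph n m → Set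
AllEdgeDeletionsSparse {m = zero} G = Unit
AllEdgeDeletionsSparse {m = suc m} G = ∀ e → ColoredLamanSparse (removeEdge G e)

ColoredLamanCircuit : ∀ {n m} → ColoredGraph n m → Set
ColoredLamanCircuit {n} {m} G =
  (∀ c k → NumComponents G Sub.⊤ Sub.⊤ c → HasRank G Sub.⊤ k →
     (+ m) ≡ ((+ 2) ℤ.* (+ n) ℤ.- (+ 2) ℤ.+ (+ 2) ℤ.* (+ k) ℤ.- (+ 2) ℤ.* ((+ c) ℤ.- (+ 1)))) ×
  AllEdgeDeletionsSparse G

module _ (ℝ : RealNumbers) where
  open RealNumbers ℝ using (Carrier; _≈_; _+_; _*_; -_; _-_; 0#; 1#)

  ℝ² : Set
  ℝ² = Fin 2 → Carrier

  Mat2 : Set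
  Mat2 = Fin 2 → Fin 2 → Carrier

  ℕ→ℝ : ℕ → Carrier
  ℕ→ℝ zero = 0#
  ℕ→ℝ (suc k) = 1# + ℕ→ℝ k

  ℤ→ℝ : ℤ → Carrier
  ℤ→ℝ (+ k) = ℕ→ℝ k
  ℤ→ℝ -[1+ k ] = - ℕ→ℝ (suc k)

  ℤ²→ℝ² : ℤ² → ℝ²
  ℤ²→ℝ² (a , b) zero = ℤ→ℝ a
  ℤ²→ℝ² (a , b) (suc _) = ℤ→ℝ b

  _+ᵥ_ _-ᵥ_ : ℝ² → ℝ² → ℝ²
  (v +ᵥ w) i = v i + w i
  (v -ᵥ w) i = v i - w i

  _⊙_ : Mat2 → ℝ² → ℝ²
  (L ⊙ v) i = L i zero * v zero + L i (suc zero) * v (suc zero)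

  ⟨_,_⟩ : ℝ² → ℝ² → Carrier
  ⟨ v , w ⟩ = v zero * w zero + v (suc zero) * w (suc zero)

  _⊥ : ℝ² → ℝ²
  (v ⊥) zero = - v (suc zero)
  (v ⊥) (suc _) = v zero

  module _ {n m : ℕ} (G : ColoredGraph n m) (d : Fin m → ℝ²) where

    IsSolution : (Fin n → ℝ²) → Mat2 → Set
    IsSolution p L = ∀ e →
      ⟨ (p (tgt G e) +ᵥ (L ⊙ ℤ²→ℝ² (col G e))) -ᵥ p (src G e) , d e ⊥ ⟩ ≈ 0#

    IsCollapsed : (Fin n → ℝ²) → Mat2 → Set
    IsCollapsed p L = ∀ e a → p (src G e) a ≈ (p (tgt G e) +ᵥ (L ⊙ ℤ²→ℝ² (col G e))) a

    Unknown : Set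
    Unknown = (Fin n × Fin 2) ⊎ (Fin 2 × Fin 2)

    -- coefficient matrix of P(G, γ, d): row e is the coefficient vector of
    -- ⟨p_tgt + L γ_e - p_src , d_e^⊥⟩ in the unknowns
    coeff : Fin m → Unknown → Carrier
    coeff e (Data.Sum.inj₁ (v , a)) =
      (if ⌊ v Fin.≟ tgt G e ⌋ then (d e ⊥) a else 0#) -
      (if ⌊ v Fin.≟ src G e ⌋ then (d e ⊥) a else 0#)
    coeff e (Data.Sum.inj₂ (a , b)) = (d e ⊥) a * ℤ²→ℝ² (col G e) b

  Σᵣ : ∀ {l} → (Fin l → Carrier) → Carrier
  Σᵣ {zero} f = 0#
  Σᵣ {suc l} f = f zero + Σᵣ (λ i → f (suc i))

  RowsIndependent : ∀ {m r} {U : Set} → (Fin m → U → Carrier) → (Fin r → Fin m) → Set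
  RowsIndependent {r = r} {U} M ι = ∀ (λs : Fin r → Carrier) →
    (∀ (u : U) → Σᵣ (λ t → λs t * M (ι t) u) ≈ 0#) → ∀ t → λs t ≈ 0#

  Injective : ∀ {r m} → (Fin r → Fin m) → Set
  Injective ι = ∀ i j → ι i ≡ ι j → i ≡ j

  HasMatrixRank : ∀ {m} {U : Set} → (Fin m → U → Carrier) → ℕ → Set
  HasMatrixRank M r =
    (∃ λ (ι : Fin r → Fin _) → Injective ι × RowsIndependent M ι) ×
    (∀ (ι : Fin (suc r) → Fin _) → Injective ι → ¬ RowsIndependent M ι)

module Submission where

-- Then every solution
-- (p, L) of P(G, γ, d) is collapsed.
--
-- Regard the rows of P and the "collapse functionals"
--   collapse e a : (p, L) ↦ (p_s − p_t − L γ_e)_a      (e : s → t)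
-- as vectors of coefficients in the unknowns (p, L).  Each row equals
-- − Σ_a (d_e^⊥)_a · collapse e a.  Fix a root in every component and a walk
-- from it to each vertex v; let Y v a be the gap between the root and v along
-- that walk.  Going around root → s → t → root shows that collapse e a is
-- Y t a − Y s a up to (L h)_a for a closed-walk colour h, which lies in the
-- cycle subgroup Γ; as rk Γ = k, these (L h)_a span at most 2k dimensions.
-- So all rows lie in the span of 2(n − c) + 2k = m generators.  The m rows are
-- independent, hence by the Steinitz exchange lemma they span the generators,
-- so every collapse functional lies in the row space and vanishes at a solution.

open import Defs
open import Algebra.Bundles using (CommutativeRing)
open import Algebra.Solver.Ring.AlmostCommutativeRing using (fromCommutativeRing; _-Raw-AlmostCommutative⟶_)
import Algebra.Solver.Ring as RingSolver
import Relation.Binary.Structures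
open import Data.Nat as N using (ℕ)
import Data.Nat.Properties as NP
import Data.Nat.Tactic.RingSolver as NatSolver
open import Data.Integer as ℤ using (ℤ; +_; -[1+_]; _⊖_)
import Data.Integer.Properties as ZP
open import Data.Integer.Tactic.RingSolver using (solve-∀)
open import Data.Fin as Fin using (Fin; splitAt; _↑ˡ_; _↑ʳ_)
import Data.Fin.Properties as FP
open import Data.Fin.Subset as Sub using ()
import Data.Fin.Subset.Properties as SubP
open import Data.Vec.Properties.WithK using ([]=-irrelevant)
open import Data.Vec.Functional using (_++_)
open import Data.Vec.Functional.Properties using (lookup-++ˡ; lookup-++ʳ)
open import Data.Bool using (Bool; true; false; not; if_then_else_)
open import Data.List as L using (List; []; _∷_; length) renaming (_++_ to _++ₗ_)
import Data.List.Properties as LP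
open import Data.List.Relation.Unary.All using (All; []; _∷_)
open import Data.List.Relation.Unary.Any as Any using (Any; here; there)
open import Data.List.Relation.Unary.All.Properties.Core using (¬Any⇒All¬)
open import Data.Maybe using (Maybe; just; nothing)
open import Data.Product using (Σ; _×_; _,_; proj₁; proj₂)
open import Data.Sum using (_⊎_; inj₁; inj₂)
open import Data.Sum.Properties using ([,]-map)
open import Data.Unit using (tt) renaming (⊤ to Unit)
open import Data.Empty using (⊥-elim)
open import Function using (_∘_)
open import Function.Bundles using (_⇔_; Equivalence)
open import Relation.Nullary using (¬_; Dec; yes; no)
open import Relation.Nullary.Decidable using (⌊_⌋)
open import Relation.Binary.PropositionalEquality as P using (_≡_)

-- Facts about an arbitrary model ℝ of the real numbers: the canonical map
-- ℤ → ℝ is a ring homomorphism (which instantiates the ring solver with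
-- integer coefficients), it is injective, and completeness yields the weak
-- excluded middle needed to locate a nonzero coefficient.
module RealFacts (ℝ : RealNumbers) where
  open RealNumbers ℝ public
  open import Relation.Binary.Reasoning.Setoid setoid public
  open import Algebra.Properties.Ring ring public
    using (-1*x≈-x; -‿involutive; -0#≈0#; -‿distribˡ-*; -‿distribʳ-*)
  open import Algebra.Properties.AbelianGroup +-abelianGroup using (⁻¹-∙-comm)

  ℕR : ℕ → Carrier
  ℕR = ℕ→ℝ ℝ

  ℤR : ℤ → Carrier
  ℤR = ℤ→ℝ ℝ

  -‿+ : ∀ x y → - (x + y) ≈ - x + - y
  -‿+ x y = sym (⁻¹-∙-comm x y)

  -- proved by hand: the solver is only available once ℤ→ℝ is a homomorphism
  +-cancel-diff : ∀ x y z → (x + y) - (x + z) ≈ y - z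
  +-cancel-diff x y z = begin
    (x + y) + - (x + z)   ≈⟨ +-congˡ (-‿+ x z) ⟩
    (x + y) + (- x + - z) ≈⟨ +-assoc _ _ _ ⟩
    x + (y + (- x + - z)) ≈⟨ +-congˡ (sym (+-assoc _ _ _)) ⟩
    x + ((y + - x) + - z) ≈⟨ +-congˡ (+-congʳ (+-comm _ _)) ⟩
    x + ((- x + y) + - z) ≈⟨ +-congˡ (+-assoc _ _ _) ⟩
    x + (- x + (y + - z)) ≈⟨ sym (+-assoc _ _ _) ⟩
    (x + - x) + (y + - z) ≈⟨ +-congʳ (-‿inverseʳ x) ⟩
    0# + (y + - z)        ≈⟨ +-identityˡ _ ⟩
    y - z                 ∎

  ℕR-+ : ∀ a b → ℕR (a N.+ b) ≈ ℕR a + ℕR b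
  ℕR-+ N.zero b = sym (+-identityˡ _)
  ℕR-+ (N.suc a) b = trans (+-congˡ (ℕR-+ a b)) (sym (+-assoc _ _ _))

  ℕR-* : ∀ a b → ℕR (a N.* b) ≈ ℕR a * ℕR b
  ℕR-* N.zero b = sym (zeroˡ _)
  ℕR-* (N.suc a) b = begin
    ℕR (b N.+ a N.* b)          ≈⟨ ℕR-+ b (a N.* b) ⟩
    ℕR b + ℕR (a N.* b)         ≈⟨ +-congˡ (ℕR-* a b) ⟩
    ℕR b + ℕR a * ℕR b          ≈⟨ +-congʳ (sym (*-identityˡ _)) ⟩
    1# * ℕR b + ℕR a * ℕR b     ≈⟨ sym (distribʳ _ _ _) ⟩
    (1# + ℕR a) * ℕR b          ∎

  ℤR-neg : ∀ i → ℤR (ℤ.- i) ≈ - ℤR i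
  ℤR-neg (+ N.zero) = sym -0#≈0#
  ℤR-neg (+ N.suc k) = refl
  ℤR-neg -[1+ k ] = sym (-‿involutive _)

  ℤR-⊖ : ∀ a b → ℤR (a ⊖ b) ≈ ℕR a - ℕR b
  ℤR-⊖ N.zero b = begin
    ℤR (0 ⊖ b)     ≡⟨ P.cong ℤR (ZP.⊖-≤ {0} {b} N.z≤n) ⟩
    ℤR (ℤ.- (+ b)) ≈⟨ ℤR-neg (+ b) ⟩
    - ℕR b         ≈⟨ sym (+-identityˡ _) ⟩
    0# - ℕR b      ∎
  ℤR-⊖ (N.suc a) N.zero = sym (trans (+-congˡ -0#≈0#) (+-identityʳ _))
  ℤR-⊖ (N.suc a) (N.suc b) = begin
    ℤR (N.suc a ⊖ N.suc b)    ≡⟨ P.cong ℤR (ZP.[1+m]⊖[1+n]≡m⊖n a b) ⟩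
    ℤR (a ⊖ b)                ≈⟨ ℤR-⊖ a b ⟩
    ℕR a - ℕR b               ≈⟨ sym (+-cancel-diff 1# (ℕR a) (ℕR b)) ⟩
    (1# + ℕR a) - (1# + ℕR b) ∎

  ℤR-+ : ∀ i j → ℤR (i ℤ.+ j) ≈ ℤR i + ℤR j
  ℤR-+ -[1+ a ] -[1+ b ] = begin
    - ℕR (N.suc (N.suc (a N.+ b)))  ≡⟨ P.cong (λ t → - ℕR t) (P.sym (NP.+-suc (N.suc a) b)) ⟩
    - ℕR (N.suc a N.+ N.suc b)      ≈⟨ -‿cong (ℕR-+ (N.suc a) (N.suc b)) ⟩
    - (ℕR (N.suc a) + ℕR (N.suc b)) ≈⟨ -‿+ _ _ ⟩
    - ℕR (N.suc a) + - ℕR (N.suc b) ∎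
  ℤR-+ -[1+ a ] (+ b) = trans (ℤR-⊖ b (N.suc a)) (+-comm _ _)
  ℤR-+ (+ a) -[1+ b ] = ℤR-⊖ a (N.suc b)
  ℤR-+ (+ a) (+ b) = ℕR-+ a b

  ℤR-*-pos : ∀ a b → ℤR (+ a ℤ.* + b) ≈ ℕR a * ℕR b
  ℤR-*-pos a b = trans (reflexive (P.cong ℤR (P.sym (ZP.pos-* a b)))) (ℕR-* a b)

  ℤR-* : ∀ i j → ℤR (i ℤ.* j) ≈ ℤR i * ℤR j
  ℤR-* (+ a) (+ b) = ℤR-*-pos a b
  ℤR-* (+ a) -[1+ b ] = begin
    ℤR (+ a ℤ.* -[1+ b ])         ≡⟨ P.cong ℤR (P.sym (ZP.neg-distribʳ-* (+ a) (+ N.suc b))) ⟩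
    ℤR (ℤ.- (+ a ℤ.* + N.suc b))  ≈⟨ ℤR-neg (+ a ℤ.* + N.suc b) ⟩
    - ℤR (+ a ℤ.* + N.suc b)      ≈⟨ -‿cong (ℤR-*-pos a (N.suc b)) ⟩
    - (ℕR a * ℕR (N.suc b))       ≈⟨ -‿distribʳ-* _ _ ⟩
    ℕR a * - ℕR (N.suc b)         ∎
  ℤR-* -[1+ a ] (+ b) = begin
    ℤR (-[1+ a ] ℤ.* + b)         ≡⟨ P.cong ℤR (P.sym (ZP.neg-distribˡ-* (+ N.suc a) (+ b))) ⟩
    ℤR (ℤ.- (+ N.suc a ℤ.* + b))  ≈⟨ ℤR-neg (+ N.suc a ℤ.* + b) ⟩
    - ℤR (+ N.suc a ℤ.* + b)      ≈⟨ -‿cong (ℤR-*-pos (N.suc a) b) ⟩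
    - (ℕR (N.suc a) * ℕR b)       ≈⟨ -‿distribˡ-* _ _ ⟩
    - ℕR (N.suc a) * ℕR b         ∎
  ℤR-* -[1+ a ] -[1+ b ] = begin
    ℤR (-[1+ a ] ℤ.* -[1+ b ])          ≡⟨ P.cong ℤR (ZP.pos-* (N.suc a) (N.suc b)) ⟩
    ℤR (+ (N.suc a N.* N.suc b))        ≈⟨ ℕR-* (N.suc a) (N.suc b) ⟩
    ℕR (N.suc a) * ℕR (N.suc b)         ≈⟨ sym (-‿involutive _) ⟩
    - - (ℕR (N.suc a) * ℕR (N.suc b))   ≈⟨ -‿cong (-‿distribˡ-* _ _) ⟩
    - (- ℕR (N.suc a) * ℕR (N.suc b))   ≈⟨ -‿distribʳ-* _ _ ⟩
    - ℕR (N.suc a) * - ℕR (N.suc b)     ∎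

  ℤR-homomorphism : CommutativeRing.rawRing ZP.+-*-commutativeRing
                      -Raw-AlmostCommutative⟶ fromCommutativeRing commRing
  ℤR-homomorphism = record
    { ⟦_⟧ = ℤR ; +-homo = ℤR-+ ; *-homo = ℤR-* ; -‿homo = ℤR-neg
    ; 0-homo = refl ; 1-homo = +-identityʳ _ }

  -- the solver only needs to recognise equal integer coefficients
  ℤR-≟ : ∀ a b → Maybe (ℤR a ≈ ℤR b)
  ℤR-≟ a b with a ℤ.≟ b
  ... | yes a≡b = just (reflexive (P.cong ℤR a≡b))
  ... | no _ = nothing

  open RingSolver _ (fromCommutativeRing commRing) ℤR-homomorphism ℤR-≟ public

  open Relation.Binary.Structures.IsTotalOrder ≤-isTotalOrder
    using (total; antisym)
    renaming (trans to ≤-trans; refl to ≤-refl; ≤-respˡ-≈ to ≤-respˡ; ≤-respʳ-≈ to ≤-respʳ)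

  -- 1 ≤ 0 is absurd: it would give 0 ≤ -1, hence 0 ≤ (-1)(-1) = 1, so 0 ≈ 1
  1≰0 : ¬ (1# ≤ᵣ 0#)
  1≰0 1≤0 = 0≉1 (antisym 0≤1′ 1≤0)
    where
      0≤-1 : 0# ≤ᵣ (- 1#)
      0≤-1 = ≤-respʳ (+-identityˡ _) (≤-respˡ (-‿inverseʳ 1#) (+-mono-≤ (- 1#) 1≤0))
      -1*-1≈1 : (- 1#) * (- 1#) ≈ 1#
      -1*-1≈1 = trans (sym (-‿distribˡ-* 1# (- 1#))) (trans (-‿cong (*-identityˡ _)) (-‿involutive _))
      0≤1′ : 0# ≤ᵣ 1#
      0≤1′ = ≤-respʳ -1*-1≈1 (*-nonneg 0≤-1 0≤-1)

  0≤1 : 0# ≤ᵣ 1#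
  0≤1 with total 0# 1#
  ... | inj₁ 0≤1 = 0≤1
  ... | inj₂ 1≤0 = ⊥-elim (1≰0 1≤0)

  1≤1+ : ∀ {x} → 0# ≤ᵣ x → 1# ≤ᵣ (1# + x)
  1≤1+ 0≤x = ≤-respʳ (+-comm _ _) (≤-respˡ (+-identityˡ _) (+-mono-≤ 1# 0≤x))

  0≤ℕR : ∀ k → 0# ≤ᵣ ℕR k
  0≤ℕR N.zero = ≤-refl
  0≤ℕR (N.suc k) = ≤-trans 0≤1 (1≤1+ (0≤ℕR k))

  ℤR≈0⇒≡0 : ∀ i → ℤR i ≈ 0# → i ≡ + 0
  ℤR≈0⇒≡0 (+ N.zero) _ = P.refl
  ℤR≈0⇒≡0 (+ N.suc k) e = ⊥-elim (1≰0 (≤-respʳ e (1≤1+ (0≤ℕR k))))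
  ℤR≈0⇒≡0 -[1+ k ] e =
    ⊥-elim (1≰0 (≤-respʳ (trans (sym (-‿involutive _)) (trans (-‿cong e) -0#≈0#)) (1≤1+ (0≤ℕR k))))

  -- Completeness decides between ¬ Q and ¬ ¬ Q: let s = sup ({0} ∪ {2 | Q});
  -- if s ≤ 1 then Q fails, and if 1 ≤ s then Q cannot fail (else s ≤ 0).
  weak-excluded-middle : (Q : Set) → (¬ Q) ⊎ (¬ ¬ Q)
  weak-excluded-middle Q with sup S (0# , inj₁ refl) (2# , bounded)
    where
      2# : Carrier
      2# = 1# + 1#
      S : Carrier → Set
      S z = (z ≈ 0#) ⊎ ((z ≈ 2#) × Q)
      bounded : ∀ x → S x → x ≤ᵣ 2#
      bounded x (inj₁ x≈0) = ≤-respˡ (sym x≈0) (≤-trans 0≤1 (1≤1+ 0≤1))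
      bounded x (inj₂ (x≈2 , _)) = ≤-respˡ (sym x≈2) ≤-refl
  ... | s , upper , least with total s 1#
  ... | inj₁ s≤1 = inj₁ λ q →
          1≰0 (≤-respˡ 2-1≈1 (≤-respʳ (-‿inverseʳ 1#) (+-mono-≤ (- 1#) (≤-trans (upper _ (inj₂ (refl , q))) s≤1))))
    where
      2-1≈1 : (1# + 1#) - 1# ≈ 1#
      2-1≈1 = trans (+-assoc _ _ _) (trans (+-congˡ (-‿inverseʳ 1#)) (+-identityʳ _))
  ... | inj₂ 1≤s = inj₂ λ ¬q → 1≰0 (≤-trans 1≤s (least 0# λ
          { x (inj₁ x≈0) → ≤-respˡ (sym x≈0) ≤-refl
          ; x (inj₂ (_ , q)) → ⊥-elim (¬q q) }))

  nonzero-entry : ∀ {b} (c : Fin b → Carrier) → ¬ (∀ j → c j ≈ 0#) → Σ (Fin b) λ j → ¬ (c j ≈ 0#)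
  nonzero-entry {N.zero} c notAllZero = ⊥-elim (notAllZero λ ())
  nonzero-entry {N.suc b} c notAllZero with weak-excluded-middle (c Fin.zero ≈ 0#)
  ... | inj₁ c₀≉0 = Fin.zero , c₀≉0
  ... | inj₂ ¬¬c₀≈0 with nonzero-entry (λ j → c (Fin.suc j))
                           (λ restZero → ¬¬c₀≈0 λ c₀≈0 → notAllZero λ { Fin.zero → c₀≈0 ; (Fin.suc j) → restZero j })
  ... | j , cj≉0 = Fin.suc j , cj≉0

  Σ-cong : ∀ {k} {f g : Fin k → Carrier} → (∀ i → f i ≈ g i) → Σᵣ ℝ f ≈ Σᵣ ℝ g
  Σ-cong {N.zero} f≈g = refl
  Σ-cong {N.suc k} f≈g = +-cong (f≈g Fin.zero) (Σ-cong (λ i → f≈g (Fin.suc i)))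

  Σ-+ : ∀ {k} (f g : Fin k → Carrier) → Σᵣ ℝ (λ i → f i + g i) ≈ Σᵣ ℝ f + Σᵣ ℝ g
  Σ-+ {N.zero} f g = sym (+-identityˡ _)
  Σ-+ {N.suc k} f g = trans (+-congˡ (Σ-+ (λ i → f (Fin.suc i)) (λ i → g (Fin.suc i))))
    (solve 4 (λ a b c d → (a :+ b) :+ (c :+ d) := (a :+ c) :+ (b :+ d)) refl _ _ _ _)

  Σ-* : ∀ {k} (a : Carrier) (f : Fin k → Carrier) → Σᵣ ℝ (λ i → a * f i) ≈ a * Σᵣ ℝ f
  Σ-* {N.zero} a f = sym (zeroʳ _)
  Σ-* {N.suc k} a f = trans (+-congˡ (Σ-* a (λ i → f (Fin.suc i)))) (sym (distribˡ _ _ _))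

  Σ-0 : ∀ {k} (f : Fin k → Carrier) → (∀ i → f i ≈ 0#) → Σᵣ ℝ f ≈ 0#
  Σ-0 {N.zero} f f≈0 = refl
  Σ-0 {N.suc k} f f≈0 = trans (+-cong (f≈0 Fin.zero) (Σ-0 _ (λ i → f≈0 (Fin.suc i)))) (+-identityˡ _)

  Σ-neg : ∀ {k} (f : Fin k → Carrier) → Σᵣ ℝ (λ i → - f i) ≈ - Σᵣ ℝ f
  Σ-neg {N.zero} f = sym -0#≈0#
  Σ-neg {N.suc k} f = trans (+-congˡ (Σ-neg (λ i → f (Fin.suc i)))) (sym (-‿+ _ _))

  Σ-punchIn : ∀ {k} (j : Fin (N.suc k)) (f : Fin (N.suc k) → Carrier) →
    Σᵣ ℝ f ≈ f j + Σᵣ ℝ (λ i → f (Fin.punchIn j i))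
  Σ-punchIn Fin.zero f = refl
  Σ-punchIn {N.suc k} (Fin.suc j) f = trans (+-congˡ (Σ-punchIn j (λ i → f (Fin.suc i))))
    (solve 3 (λ a b c → a :+ (b :+ c) := b :+ (a :+ c)) refl _ _ _)

  δ : ∀ {k} → Fin k → Fin k → Carrier
  δ Fin.zero Fin.zero = 1#
  δ Fin.zero (Fin.suc j) = 0#
  δ (Fin.suc i) Fin.zero = 0#
  δ (Fin.suc i) (Fin.suc j) = δ i j

  Σ-δ : ∀ {k} (i : Fin k) (f : Fin k → Carrier) → Σᵣ ℝ (λ j → δ i j * f j) ≈ f i
  Σ-δ {N.suc k} Fin.zero f =
    trans (+-cong (*-identityˡ _) (Σ-0 (λ j → 0# * f (Fin.suc j)) (λ j → zeroˡ _))) (+-identityʳ _)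
  Σ-δ {N.suc k} (Fin.suc i) f = trans (+-cong (zeroˡ _) (Σ-δ i (λ j → f (Fin.suc j)))) (+-identityˡ _)

  Σ-δʳ : ∀ {k} (i : Fin k) (f : Fin k → Carrier) → Σᵣ ℝ (λ j → f j * δ j i) ≈ f i
  Σ-δʳ {N.suc k} Fin.zero f =
    trans (+-cong (*-identityʳ _) (Σ-0 (λ j → f (Fin.suc j) * 0#) (λ j → zeroʳ _))) (+-identityʳ _)
  Σ-δʳ {N.suc k} (Fin.suc i) f = trans (+-cong (zeroʳ _) (Σ-δʳ i (λ j → f (Fin.suc j)))) (+-identityˡ _)

  -- δ u v is the indicator of v ≡ u, in the form used by the definition of P
  δ-select : ∀ {k} (u v : Fin k) x → δ u v * x ≈ (if ⌊ v Fin.≟ u ⌋ then x else 0#)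
  δ-select Fin.zero Fin.zero x = *-identityˡ x
  δ-select Fin.zero (Fin.suc v) x = zeroˡ x
  δ-select (Fin.suc u) Fin.zero x = zeroˡ x
  δ-select (Fin.suc u) (Fin.suc v) x with v Fin.≟ u | δ-select u v x
  ... | yes _ | selected = selected
  ... | no _ | selected = selected

module LinearAlgebra (ℝ : RealNumbers) (U : Set) where
  open RealFacts ℝ

  V : Set
  V = U → Carrier

  infix 4 _≋_
  infixl 6 _+V_ _-V_
  infixr 7 _·V_

  _≋_ : V → V → Set
  v ≋ w = ∀ u → v u ≈ w u

  0V : V
  0V u = 0#

  _+V_ _-V_ : V → V → V
  (v +V w) u = v u + w u
  (v -V w) u = v u - w u

  _·V_ : Carrier → V → V
  (c ·V v) u = c * v u

  lin : ∀ {k} → (Fin k → Carrier) → (Fin k → V) → V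
  lin c B u = Σᵣ ℝ (λ i → c i * B i u)

  data Span (S : V → Set) : V → Set where
    gen     : ∀ {v} → S v → Span S v
    span-0  : Span S 0V
    span-+  : ∀ {v w} → Span S v → Span S w → Span S (v +V w)
    span-·  : ∀ {v} c → Span S v → Span S (c ·V v)
    span-≋  : ∀ {v w} → v ≋ w → Span S v → Span S w

  span-trans : ∀ {S T : V → Set} → (∀ v → S v → Span T v) → ∀ {v} → Span S v → Span T v
  span-trans S⊆T (gen s) = S⊆T _ s
  span-trans S⊆T span-0 = span-0
  span-trans S⊆T (span-+ s t) = span-+ (span-trans S⊆T s) (span-trans S⊆T t)
  span-trans S⊆T (span-· c s) = span-· c (span-trans S⊆T s)
  span-trans S⊆T (span-≋ e s) = span-≋ e (span-trans S⊆T s)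

  span-- : ∀ {S v w} → Span S v → Span S w → Span S (v -V w)
  span-- s t = span-≋ (λ u → +-congˡ (-1*x≈-x _)) (span-+ s (span-· (- 1#) t))

  lin∈span : ∀ {S : V → Set} {k} (c : Fin k → Carrier) (B : Fin k → V) → (∀ i → Span S (B i)) → Span S (lin c B)
  lin∈span {k = N.zero} c B B⊆S = span-≋ (λ u → refl) span-0
  lin∈span {k = N.suc k} c B B⊆S = span-≋ (λ u → refl)
    (span-+ (span-· (c Fin.zero) (B⊆S Fin.zero))
            (lin∈span (λ i → c (Fin.suc i)) (λ i → B (Fin.suc i)) (λ i → B⊆S (Fin.suc i))))

  Among : ∀ {l} → (Fin l → V) → V → Set
  Among {l} B v = Σ (Fin l) λ i → v ≋ B i

  _∪_ : (V → Set) → (V → Set) → V → Set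
  (S ∪ T) v = S v ⊎ T v

  lin-cong : ∀ {k} {c d : Fin k → Carrier} (B : Fin k → V) → (∀ i → c i ≈ d i) → lin c B ≋ lin d B
  lin-cong B c≈d u = Σ-cong (λ i → *-congʳ (c≈d i))

  lin-+ : ∀ {k} (c d : Fin k → Carrier) (B : Fin k → V) → lin (λ i → c i + d i) B ≋ lin c B +V lin d B
  lin-+ c d B u = trans (Σ-cong (λ i → distribʳ (B i u) (c i) (d i))) (Σ-+ (λ i → c i * B i u) (λ i → d i * B i u))

  lin-· : ∀ {k} a (c : Fin k → Carrier) (B : Fin k → V) → lin (λ i → a * c i) B ≋ a ·V lin c B
  lin-· a c B u = trans (Σ-cong (λ i → *-assoc a (c i) (B i u))) (Σ-* a (λ i → c i * B i u))

  lin-neg : ∀ {k} (c : Fin k → Carrier) (B : Fin k → V) → lin (λ i → - c i) B ≋ 0V -V lin c B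
  lin-neg c B u = trans (Σ-cong (λ i → sym (-‿distribˡ-* (c i) (B i u))))
                        (trans (Σ-neg (λ i → c i * B i u)) (sym (+-identityˡ _)))

  lin-0 : ∀ {k} (B : Fin k → V) → lin (λ _ → 0#) B ≋ 0V
  lin-0 B u = Σ-0 (λ i → 0# * B i u) (λ i → zeroˡ _)

  lin-δ : ∀ {k} (i : Fin k) (B : Fin k → V) → lin (δ i) B ≋ B i
  lin-δ i B u = Σ-δ i (λ j → B j u)

  Combination : ∀ {f b} → (Fin f → V) → (Fin b → V) → V → Set
  Combination {f} {b} F B v =
    Σ (Fin f → Carrier) λ cF → Σ (Fin b → Carrier) λ cB → v ≋ lin cF F +V lin cB B

  span⇒combination : ∀ {f b} {F : Fin f → V} {B : Fin b → V} {v} →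
    Span (Among F ∪ Among B) v → Combination F B v
  span⇒combination {F = F} {B} (gen (inj₁ (i , v≋Fi))) = δ i , (λ _ → 0#) , λ u →
    trans (v≋Fi u) (sym (trans (+-cong (lin-δ i F u) (lin-0 B u)) (+-identityʳ _)))
  span⇒combination {F = F} {B} (gen (inj₂ (j , v≋Bj))) = (λ _ → 0#) , δ j , λ u →
    trans (v≋Bj u) (sym (trans (+-cong (lin-0 F u) (lin-δ j B u)) (+-identityˡ _)))
  span⇒combination {F = F} {B} span-0 = (λ _ → 0#) , (λ _ → 0#) , λ u →
    sym (trans (+-cong (lin-0 F u) (lin-0 B u)) (+-identityˡ _))
  span⇒combination {F = F} {B} (span-+ s t) with span⇒combination s | span⇒combination t
  ... | cF , cB , e | dF , dB , e' = (λ i → cF i + dF i) , (λ i → cB i + dB i) , λ u →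
    trans (+-cong (e u) (e' u)) (sym (trans (+-cong (lin-+ cF dF F u) (lin-+ cB dB B u))
      (solve 4 (λ a b c d → (a :+ c) :+ (b :+ d) := (a :+ b) :+ (c :+ d)) refl _ _ _ _)))
  span⇒combination {F = F} {B} (span-· a s) with span⇒combination s
  ... | cF , cB , e = (λ i → a * cF i) , (λ i → a * cB i) , λ u →
    trans (*-congˡ (e u)) (sym (trans (+-cong (lin-· a cF F u) (lin-· a cB B u)) (sym (distribˡ _ _ _))))
  span⇒combination (span-≋ v≋w s) with span⇒combination s
  ... | cF , cB , e = cF , cB , λ u → trans (sym (v≋w u)) (e u)

  _◂_ : ∀ {k} {A : Set} → A → (Fin k → A) → Fin (N.suc k) → A
  (a ◂ f) Fin.zero = a
  (a ◂ f) (Fin.suc i) = f i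

  IndependentModulo : ∀ {f r} → (Fin f → V) → (Fin r → V) → Set
  IndependentModulo {f} {r} F R = ∀ (λF : Fin f → Carrier) (λR : Fin r → Carrier) →
    lin λF F +V lin λR R ≋ 0V → ∀ t → λR t ≈ 0#

  -- In R₀ = Σ cF F + Σ cB B the coefficients cB cannot all vanish, since
  -- R₀ is independent of F.
  pivot-exists : ∀ {f r b} {F : Fin f → V} {R : Fin (N.suc r) → V} (B : Fin b → V) →
    IndependentModulo F R → ∀ cF cB → R Fin.zero ≋ lin cF F +V lin cB B → ¬ (∀ j → cB j ≈ 0#)
  pivot-exists {F = F} {R} B indep cF cB R₀≋ cB≈0 =
    0≉1 (sym (indep (λ i → - cF i) (δ Fin.zero) vanishes Fin.zero))
    where
      vanishes : lin (λ i → - cF i) F +V lin (δ Fin.zero) R ≋ 0V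
      vanishes u = begin
        lin (λ i → - cF i) F u + lin (δ Fin.zero) R u ≈⟨ +-cong (lin-neg cF F u) (lin-δ Fin.zero R u) ⟩
        (0# - lin cF F u) + R Fin.zero u                ≈⟨ +-congˡ (R₀≋ u) ⟩
        (0# - lin cF F u) + (lin cF F u + lin cB B u)   ≈⟨ +-congˡ (+-congˡ (trans (lin-cong B cB≈0 u) (lin-0 B u))) ⟩
        (0# - lin cF F u) + (lin cF F u + 0#)
          ≈⟨ solve 1 (λ a → (con (+ 0) :- a) :+ (a :+ con (+ 0)) := con (+ 0)) refl _ ⟩
        0#                                              ∎

  -- One exchange step.  If R₀ = Σ cF F + Σ cB B and cB j₀ has inverse y, then
  -- B j₀ = y (R₀ − Σ cF F − Σ_{j ≠ j₀} cB_j B_j) lies in the span of R₀, F and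
  -- the remaining vectors B ∘ punchIn j₀.
  pivot-in-span : ∀ {f b} (F : Fin f → V) (B : Fin (N.suc b) → V) {R₀ : V} cF cB →
    R₀ ≋ lin cF F +V lin cB B → ∀ j₀ {y} → cB j₀ * y ≈ 1# →
    Span (Among (R₀ ◂ F) ∪ Among (λ i → B (Fin.punchIn j₀ i))) (B j₀)
  pivot-in-span {b = b} F B {R₀} cF cB R₀≋ j₀ {y} inv = span-≋ solved
    (span-· y (span-- (span-- (gen (inj₁ (Fin.zero , λ u → refl)))
                              (lin∈span cF F (λ i → gen (inj₁ (Fin.suc i , λ u → refl)))))
                      (lin∈span cB' B' (λ i → gen (inj₂ (i , λ u → refl))))))
    where
      B' : Fin b → V
      B' i = B (Fin.punchIn j₀ i)
      cB' : Fin b → Carrier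
      cB' i = cB (Fin.punchIn j₀ i)
      solved : y ·V ((R₀ -V lin cF F) -V lin cB' B') ≋ B j₀
      solved u = begin
        y * ((R₀ u - lin cF F u) - lin cB' B' u)
          ≈⟨ *-congˡ (+-congʳ (+-congʳ (R₀≋ u))) ⟩
        y * (((lin cF F u + lin cB B u) - lin cF F u) - lin cB' B' u)
          ≈⟨ *-congˡ (+-congʳ (+-congʳ (+-congˡ (Σ-punchIn j₀ (λ i → cB i * B i u))))) ⟩
        y * (((lin cF F u + (cB j₀ * B j₀ u + lin cB' B' u)) - lin cF F u) - lin cB' B' u)
          ≈⟨ solve 5 (λ y a c b d → y :* (((a :+ (c :* b :+ d)) :- a) :- d) := (c :* y) :* b) refl y _ _ _ _ ⟩
        (cB j₀ * y) * B j₀ u ≈⟨ *-congʳ inv ⟩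
        1# * B j₀ u          ≈⟨ *-identityˡ _ ⟩
        B j₀ u               ∎

  -- Induction on |R|: exchange R₀ for a pivot B_{j₀}.
  Exchange : ℕ → Set
  Exchange r = ∀ {f b} (F : Fin f → V) (R : Fin r → V) (B : Fin b → V) →
    IndependentModulo F R → (∀ i → Span (Among F ∪ Among B) (R i)) → b N.≤ r →
    ∀ j → Span (Among F ∪ Among R) (B j)

  exchange : ∀ r → Exchange r
  exchange r {b = N.zero} F R B indep R⊆ b≤r ()
  exchange N.zero {b = N.suc b} F R B indep R⊆ ()
  exchange (N.suc r) {f} {N.suc b} F R B indep R⊆ b≤r
    with span⇒combination (R⊆ Fin.zero)
  ... | cF , cB , R₀≋ with nonzero-entry cB (pivot-exists {F = F} {R} B indep cF cB R₀≋)
  ... | j₀ , cBj₀≉0 with inverse (cB j₀) cBj₀≉0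
  ... | y , inv = B⊆
    where
      F' : Fin (N.suc f) → V
      F' = R Fin.zero ◂ F
      R' : Fin r → V
      R' t = R (Fin.suc t)
      B' : Fin b → V
      B' i = B (Fin.punchIn j₀ i)
      pivot : Span (Among F' ∪ Among B') (B j₀)
      pivot = pivot-in-span F B cF cB R₀≋ j₀ inv

      old⊆new : ∀ v → (Among F ∪ Among B) v → Span (Among F' ∪ Among B') v
      old⊆new v (inj₁ (i , v≋)) = gen (inj₁ (Fin.suc i , v≋))
      old⊆new v (inj₂ (j , v≋)) with j Fin.≟ j₀
      ... | yes P.refl = span-≋ (λ u → sym (v≋ u)) pivot
      ... | no j≢j₀ = gen (inj₂ (Fin.punchOut (P.≢-sym j≢j₀) , λ u →
              trans (v≋ u) (reflexive (P.cong (λ k → B k u) (P.sym (FP.punchIn-punchOut (P.≢-sym j≢j₀)))))))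

      indep' : IndependentModulo F' R'
      indep' λF' λR' vanishes t = indep (λ i → λF' (Fin.suc i)) (λF' Fin.zero ◂ λR')
        (λ u → trans (solve 3 (λ x a y → x :+ (a :+ y) := (a :+ x) :+ y) refl _ _ _) (vanishes u)) (Fin.suc t)

      B'⊆ : ∀ i → Span (Among F' ∪ Among R') (B' i)
      B'⊆ = exchange r F' R' B' indep' (λ t → span-trans old⊆new (R⊆ (Fin.suc t))) (NP.≤-pred b≤r)

      regroup : ∀ v → (Among F' ∪ Among R') v → Span (Among F ∪ Among R) v
      regroup v (inj₁ (Fin.zero , v≋)) = gen (inj₂ (Fin.zero , v≋))
      regroup v (inj₁ (Fin.suc i , v≋)) = gen (inj₁ (i , v≋))
      regroup v (inj₂ (t , v≋)) = gen (inj₂ (Fin.suc t , v≋))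

      B⊆ : ∀ j → Span (Among F ∪ Among R) (B j)
      B⊆ j with j Fin.≟ j₀
      ... | yes P.refl = span-trans new⊆ pivot
        where
          new⊆ : ∀ v → (Among F' ∪ Among B') v → Span (Among F ∪ Among R) v
          new⊆ v (inj₁ x) = regroup v (inj₁ x)
          new⊆ v (inj₂ (i , v≋)) = span-≋ (λ u → sym (v≋ u)) (span-trans regroup (B'⊆ i))
      ... | no j≢j₀ = span-≋ (λ u → reflexive (P.cong (λ k → B k u) (FP.punchIn-punchOut (P.≢-sym j≢j₀))))
                             (span-trans regroup (B'⊆ (Fin.punchOut (P.≢-sym j≢j₀))))

  exchange-independent : ∀ {r b} (R : Fin r → V) (B : Fin b → V) →
    (∀ λR → lin λR R ≋ 0V → ∀ t → λR t ≈ 0#) → (∀ i → Span (Among B) (R i)) → b N.≤ r →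
    ∀ j → Span (Among R) (B j)
  exchange-independent {r} R B indep R⊆ b≤r j =
    span-trans onlyR (exchange r none R B indep' (λ i → span-trans (λ v a → gen (inj₂ a)) (R⊆ i)) b≤r j)
    where
      none : Fin 0 → V
      none ()
      indep' : IndependentModulo none R
      indep' _ λR vanishes = indep λR (λ u → trans (sym (+-identityˡ _)) (vanishes u))
      onlyR : ∀ v → (Among none ∪ Among R) v → Span (Among R) v
      onlyR v (inj₂ a) = gen a

pair≡ : ∀ {a b c d : ℤ} → a ≡ c → b ≡ d → (a , b) ≡ (c , d)
pair≡ P.refl P.refl = P.refl

+²-assoc : ∀ x y z → (x +² y) +² z ≡ x +² (y +² z)
+²-assoc (a , b) (c , d) (e , f) = pair≡ (ZP.+-assoc a c e) (ZP.+-assoc b d f)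

+²-comm : ∀ x y → x +² y ≡ y +² x
+²-comm (a , b) (c , d) = pair≡ (ZP.+-comm a c) (ZP.+-comm b d)

+²-identityˡ : ∀ x → 0² +² x ≡ x
+²-identityˡ (a , b) = pair≡ (ZP.+-identityˡ a) (ZP.+-identityˡ b)

+²-identityʳ : ∀ x → x +² 0² ≡ x
+²-identityʳ (a , b) = pair≡ (ZP.+-identityʳ a) (ZP.+-identityʳ b)

+²-inverseʳ : ∀ x → x +² (-² x) ≡ 0²
+²-inverseʳ (a , b) = pair≡ (ZP.+-inverseʳ a) (ZP.+-inverseʳ b)

-²-involutive : ∀ x → -² (-² x) ≡ x
-²-involutive (a , b) = pair≡ (ZP.neg-involutive a) (ZP.neg-involutive b)

-²-distrib : ∀ x y → -² (x +² y) ≡ (-² x) +² (-² y)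
-²-distrib (a , b) (c , d) = pair≡ (ZP.neg-distrib-+ a c) (ZP.neg-distrib-+ b d)

·²-identity : ∀ x → ((+ 1) ·² x) +² 0² ≡ x
·²-identity (a , b) = pair≡ (P.trans (ZP.+-identityʳ _) (ZP.*-identityˡ a))
                            (P.trans (ZP.+-identityʳ _) (ZP.*-identityˡ b))

+²-exchange : ∀ x y z → x +² (y +² z) ≡ y +² (x +² z)
+²-exchange x y z =
  P.trans (P.sym (+²-assoc x y z)) (P.trans (P.cong (_+² z) (+²-comm x y)) (+²-assoc y x z))

Σ²-cong : ∀ {l} {f g : Fin l → ℤ²} → (∀ i → f i ≡ g i) → Σ² f ≡ Σ² g
Σ²-cong {N.zero} f≡g = P.refl
Σ²-cong {N.suc l} f≡g = P.cong₂ _+²_ (f≡g Fin.zero) (Σ²-cong (λ i → f≡g (Fin.suc i)))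

Σ²-++ : ∀ {l₁ l₂} (f : Fin l₁ → ℤ²) (g : Fin l₂ → ℤ²) → Σ² (f ++ g) ≡ Σ² f +² Σ² g
Σ²-++ {N.zero} f g = P.sym (+²-identityˡ _)
Σ²-++ {N.suc l₁} f g = P.trans
  (P.cong (f Fin.zero +²_) (P.trans (Σ²-cong (λ i → [,]-map (splitAt l₁ i))) (Σ²-++ (f ∘ Fin.suc) g)))
  (P.sym (+²-assoc (f Fin.zero) (Σ² (f ∘ Fin.suc)) (Σ² g)))

zipWith-++ : ∀ {A B C : Set} (h : A → B → C) {l₁ l₂} (a : Fin l₁ → A) (b : Fin l₂ → A)
  (c : Fin l₁ → B) (d : Fin l₂ → B) i →
  h ((a ++ b) i) ((c ++ d) i) ≡ ((λ j → h (a j) (c j)) ++ (λ j → h (b j) (d j))) i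
zipWith-++ h {l₁} a b c d i with splitAt l₁ i
... | inj₁ j = P.refl
... | inj₂ j = P.refl

-- The colour of every closed walk
-- lies in the cycle subgroup Γ: a closed walk with a repeated vertex splits
-- into two shorter closed walks; one with distinct vertices but a repeated
-- edge is a back-and-forth along a single edge (colour 0); and one without
-- repetitions is a simple cycle.
module ClosedWalks {n m : ℕ} (G : ColoredGraph n m) where

  Step : Set
  Step = Fin m × Bool

  from to : Step → Fin n
  from s = stepFrom G (proj₁ s) (proj₂ s)
  to s = stepTo G (proj₁ s) (proj₂ s)

  colour : Step → ℤ²
  colour s = stepColor G (proj₁ s) (proj₂ s)

  IsWalk : Fin n → Fin n → List Step → Set
  IsWalk u w [] = u ≡ w
  IsWalk u w (s ∷ ss) = (from s ≡ u) × IsWalk (to s) w ss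

  walkColour : List Step → ℤ²
  walkColour [] = 0²
  walkColour (s ∷ ss) = colour s +² walkColour ss

  walkColour-++ : ∀ xs ys → walkColour (xs ++ₗ ys) ≡ walkColour xs +² walkColour ys
  walkColour-++ [] ys = P.sym (+²-identityˡ _)
  walkColour-++ (x ∷ xs) ys = P.trans (P.cong (colour x +²_) (walkColour-++ xs ys))
                                      (P.sym (+²-assoc (colour x) (walkColour xs) (walkColour ys)))

  walk-++ : ∀ {u v w} xs {ys} → IsWalk u v xs → IsWalk v w ys → IsWalk u w (xs ++ₗ ys)
  walk-++ [] P.refl q = q
  walk-++ (x ∷ xs) (e , p) q = e , walk-++ xs p q

  walk-split : ∀ xs {u w} y ys → IsWalk u w (xs ++ₗ y ∷ ys) →
    IsWalk u (from y) xs × IsWalk (from y) w (y ∷ ys)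
  walk-split [] y ys (e , p) = P.sym e , (P.refl , p)
  walk-split (x ∷ xs) y ys (e , p) with walk-split xs y ys p
  ... | p₁ , p₂ = (e , p₁) , p₂

  walk-subst : ∀ {u u' w w'} xs → u ≡ u' → w ≡ w' → IsWalk u w xs → IsWalk u' w' xs
  walk-subst xs P.refl P.refl p = p

  reverse-step : Step → Step
  reverse-step (e , b) = (e , not b)

  reverse : List Step → List Step
  reverse [] = []
  reverse (s ∷ ss) = reverse ss ++ₗ (reverse-step s ∷ [])

  walk-reverse : ∀ ss {u w} → IsWalk u w ss → IsWalk w u (reverse ss)
  walk-reverse [] P.refl = P.refl
  walk-reverse ((e , true) ∷ ss) (e₀ , p) = walk-++ (reverse ss) (walk-reverse ss p) (P.refl , e₀)
  walk-reverse ((e , false) ∷ ss) (e₀ , p) = walk-++ (reverse ss) (walk-reverse ss p) (P.refl , e₀)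

  colour-reverse-step : ∀ s → colour (reverse-step s) ≡ -² colour s
  colour-reverse-step (e , true) = P.refl
  colour-reverse-step (e , false) = P.sym (-²-involutive (col G e))

  walkColour-reverse : ∀ ss → walkColour (reverse ss) ≡ -² walkColour ss
  walkColour-reverse [] = P.refl
  walkColour-reverse (s ∷ ss) = begin
    walkColour (reverse ss ++ₗ (reverse-step s ∷ []))
      ≡⟨ walkColour-++ (reverse ss) (reverse-step s ∷ []) ⟩
    walkColour (reverse ss) +² (colour (reverse-step s) +² 0²)
      ≡⟨ P.cong₂ _+²_ (walkColour-reverse ss) (P.trans (+²-identityʳ _) (colour-reverse-step s)) ⟩
    (-² walkColour ss) +² (-² colour s)
      ≡⟨ +²-comm (-² walkColour ss) (-² colour s) ⟩
    (-² colour s) +² (-² walkColour ss)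
      ≡⟨ P.sym (-²-distrib (colour s) (walkColour ss)) ⟩
    -² (colour s +² walkColour ss) ∎
    where open P.≡-Reasoning

  walk→steps : ∀ {S u w} → Walk G S u w → Σ (List Step) (IsWalk u w)
  walk→steps [] = [] , P.refl
  walk→steps ((e , b , _ , from≡) ∷ wk) with walk→steps wk
  ... | ss , p = (e , b) ∷ ss , from≡ , p

  Γ : ℤ² → Set
  Γ = InCycleSubgroup G Sub.⊤

  Γ-0 : Γ 0²
  Γ-0 = 0 , (λ ()) , (λ ()) , P.refl

  Γ-cycle : (C : SimpleCycle G Sub.⊤) → Γ (ρ G C)
  Γ-cycle C = 1 , (λ _ → + 1) , (λ _ → C) , P.sym (·²-identity _)

  Γ-+ : ∀ {g h} → Γ g → Γ h → Γ (g +² h)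
  Γ-+ {g} {h} (l₁ , a₁ , C₁ , g≡) (l₂ , a₂ , C₂ , h≡) = l₁ N.+ l₂ , a₁ ++ a₂ , C₁ ++ C₂ , (begin
    g +² h                                        ≡⟨ P.cong₂ _+²_ g≡ h≡ ⟩
    Σ² (term a₁ C₁) +² Σ² (term a₂ C₂)            ≡⟨ P.sym (Σ²-++ (term a₁ C₁) (term a₂ C₂)) ⟩
    Σ² (term a₁ C₁ ++ term a₂ C₂)                 ≡⟨ P.sym (Σ²-cong (zipWith-++ (λ a C → a ·² ρ G C) a₁ a₂ C₁ C₂)) ⟩
    Σ² (term (a₁ ++ a₂) (C₁ ++ C₂))               ∎)
    where
      open P.≡-Reasoning
      term : ∀ {l} → (Fin l → ℤ) → (Fin l → SimpleCycle G Sub.⊤) → Fin l → ℤ²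
      term a C i = a i ·² ρ G (C i)

  DistinctBy : {B : Set} → (Step → B) → List Step → Set
  DistinctBy f [] = Unit
  DistinctBy f (s ∷ ss) = All (λ s' → ¬ (f s' ≡ f s)) ss × DistinctBy f ss

  Repetition : {B : Set} → (Step → B) → List Step → Set
  Repetition f ss = Σ (List Step) λ as → Σ (List Step) λ bs → Σ (List Step) λ cs → Σ Step λ x → Σ Step λ y →
    (ss ≡ as ++ₗ x ∷ (bs ++ₗ y ∷ cs)) × (f x ≡ f y)

  any-split : ∀ {Q : Step → Set} ss → Any Q ss →
    Σ (List Step) λ bs → Σ Step λ y → Σ (List Step) λ cs → (ss ≡ bs ++ₗ y ∷ cs) × Q y
  any-split (s ∷ ss) (here q) = [] , s , ss , P.refl , q
  any-split (s ∷ ss) (there a) with any-split ss a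
  ... | bs , y , cs , e , q = s ∷ bs , y , cs , P.cong (s ∷_) e , q

  repetition-or-distinct : {B : Set} (f : Step → B) → (∀ (a b : B) → Dec (a ≡ b)) →
    ∀ ss → Repetition f ss ⊎ DistinctBy f ss
  repetition-or-distinct f _≟_ [] = inj₂ tt
  repetition-or-distinct f _≟_ (s ∷ ss) with Any.any? (λ s' → f s' ≟ f s) ss
  ... | yes a with any-split ss a
  ...   | bs , y , cs , e , q = inj₁ ([] , bs , cs , s , y , P.cong (s ∷_) e , P.sym q)
  repetition-or-distinct f _≟_ (s ∷ ss) | no ¬a with repetition-or-distinct f _≟_ ss
  ... | inj₁ (as , bs , cs , x , y , e , q) = inj₁ (s ∷ as , bs , cs , x , y , P.cong (s ∷_) e , q)
  ... | inj₂ d = inj₂ (¬Any⇒All¬ ss ¬a , d)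

  distinct-suffix : ∀ {B : Set} {f : Step → B} as {zs} → DistinctBy f (as ++ₗ zs) → DistinctBy f zs
  distinct-suffix [] d = d
  distinct-suffix (a ∷ as) (_ , d) = distinct-suffix as d

  all-lookup : ∀ {Q : Step → Set} {xs} → All Q xs → ∀ i → Q (L.lookup xs i)
  all-lookup (q ∷ qs) Fin.zero = q
  all-lookup (q ∷ qs) (Fin.suc i) = all-lookup qs i

  all-middle : ∀ {Q : Step → Set} bs {y cs} → All Q (bs ++ₗ y ∷ cs) → Q y
  all-middle [] (q ∷ _) = q
  all-middle (b ∷ bs) (_ ∷ qs) = all-middle bs qs

  lookup-injective : ∀ {B : Set} (f : Step → B) xs → DistinctBy f xs →
    ∀ i j → f (L.lookup xs i) ≡ f (L.lookup xs j) → i ≡ j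
  lookup-injective f (x ∷ xs) d Fin.zero Fin.zero e = P.refl
  lookup-injective f (x ∷ xs) (a , d) Fin.zero (Fin.suc j) e = ⊥-elim (all-lookup a j (P.sym e))
  lookup-injective f (x ∷ xs) (a , d) (Fin.suc i) Fin.zero e = ⊥-elim (all-lookup a i e)
  lookup-injective f (x ∷ xs) (a , d) (Fin.suc i) (Fin.suc j) e =
    P.cong Fin.suc (lookup-injective f xs d i j e)

  walk-chain : ∀ s₀ ss {u w} → IsWalk u w (s₀ ∷ ss) → ∀ (i : Fin (length ss)) →
    to (L.lookup (s₀ ∷ ss) (Fin.inject₁ i)) ≡ from (L.lookup ss i)
  walk-chain s₀ (s₁ ∷ ss) (_ , e₁ , p) Fin.zero = P.sym e₁
  walk-chain s₀ (s₁ ∷ ss) (_ , p) (Fin.suc i) = walk-chain s₁ ss p i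

  walk-end : ∀ s₀ ss {u w} → IsWalk u w (s₀ ∷ ss) → to (L.lookup (s₀ ∷ ss) (Fin.fromℕ (length ss))) ≡ w
  walk-end s₀ [] (_ , p) = p
  walk-end s₀ (s₁ ∷ ss) (_ , p) = walk-end s₁ ss p

  Σ²-lookup : ∀ xs → Σ² {length xs} (λ i → colour (L.lookup xs i)) ≡ walkColour xs
  Σ²-lookup [] = P.refl
  Σ²-lookup (x ∷ xs) = P.cong (colour x +²_) (Σ²-lookup xs)

  simple-cycle : ∀ s₀ ss {u} → IsWalk u u (s₀ ∷ ss) → DistinctBy from (s₀ ∷ ss) → DistinctBy proj₁ (s₀ ∷ ss) →
    Σ (SimpleCycle G Sub.⊤) λ C → ρ G C ≡ walkColour (s₀ ∷ ss)
  simple-cycle s₀ ss p distinctVertices distinctEdges = record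
    { len = length ss
    ; edge = λ i → proj₁ (L.lookup (s₀ ∷ ss) i)
    ; dir = λ i → proj₂ (L.lookup (s₀ ∷ ss) i)
    ; inS = λ i → SubP.∈⊤
    ; edge-inj = lookup-injective proj₁ (s₀ ∷ ss) distinctEdges
    ; vertex-inj = lookup-injective from (s₀ ∷ ss) distinctVertices
    ; chain = walk-chain s₀ ss p
    ; close = P.trans (walk-end s₀ ss p) (P.sym (proj₁ p))
    } , Σ²-lookup (s₀ ∷ ss)

  -- A closed walk with distinct vertices traversing an edge twice, in opposite
  -- directions, consists of just these two steps, so its colour is 0.
  back-and-forth : ∀ as x bs y cs {u} → DistinctBy from (as ++ₗ x ∷ (bs ++ₗ y ∷ cs)) →
    IsWalk u u (as ++ₗ x ∷ (bs ++ₗ y ∷ cs)) → from y ≡ to x → to y ≡ from x → colour x +² colour y ≡ 0² →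
    walkColour (as ++ₗ x ∷ (bs ++ₗ y ∷ cs)) ≡ 0²
  back-and-forth as x (b₀ ∷ bs) y cs d p y-from x-from _ with walk-split as x (b₀ ∷ bs ++ₗ y ∷ cs) p
  ... | _ , (_ , b₀-from , _) =
    ⊥-elim (all-middle bs (proj₁ (proj₂ (distinct-suffix as d))) (P.trans y-from (P.sym b₀-from)))
  back-and-forth as x [] y (c₀ ∷ cs) d p _ x-from _ with walk-split as x (y ∷ c₀ ∷ cs) p
  ... | _ , (_ , _ , c₀-from , _) with proj₁ (distinct-suffix as d)
  ...   | _ ∷ (c₀≠x ∷ _) = ⊥-elim (c₀≠x (P.trans c₀-from x-from))
  back-and-forth (a₀ ∷ as) x [] y [] (a , d) (a₀-from , p) _ x-from _ with walk-split as x (y ∷ []) p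
  ... | _ , (_ , _ , y-to) = ⊥-elim (all-middle as a (P.trans (P.sym x-from) (P.trans y-to (P.sym a₀-from))))
  back-and-forth [] x [] y [] d p _ _ cancel = P.trans (P.cong (colour x +²_) (+²-identityʳ (colour y))) cancel

  -- a closed walk with distinct vertices repeating an edge has colour 0:
  -- repeating it in the same direction would repeat a vertex
  repeated-edge : ∀ as x bs y cs {u} → DistinctBy from (as ++ₗ x ∷ (bs ++ₗ y ∷ cs)) →
    IsWalk u u (as ++ₗ x ∷ (bs ++ₗ y ∷ cs)) → proj₁ x ≡ proj₁ y →
    walkColour (as ++ₗ x ∷ (bs ++ₗ y ∷ cs)) ≡ 0²
  repeated-edge as (e , true) bs (.e , true) cs d p P.refl =
    ⊥-elim (all-middle bs (proj₁ (distinct-suffix as d)) P.refl)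
  repeated-edge as (e , false) bs (.e , false) cs d p P.refl =
    ⊥-elim (all-middle bs (proj₁ (distinct-suffix as d)) P.refl)
  repeated-edge as (e , true) bs (.e , false) cs d p P.refl =
    back-and-forth as _ bs _ cs d p P.refl P.refl (+²-inverseʳ (col G e))
  repeated-edge as (e , false) bs (.e , true) cs d p P.refl =
    back-and-forth as _ bs _ cs d p P.refl P.refl (P.trans (+²-comm (-² col G e) (col G e)) (+²-inverseʳ (col G e)))

  pieces-shorter : ∀ {p q k} → p N.+ q N.≤ N.suc k → 0 N.< p → 0 N.< q → (p N.≤ k) × (q N.≤ k)
  pieces-shorter {N.suc p} {N.suc q} {k} total _ _ =
    NP.≤-trans p≤ bound , NP.≤-trans (NP.m≤n+m (N.suc q) p) bound
    where
      bound : p N.+ N.suc q N.≤ k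
      bound = NP.≤-pred total
      p≤ : N.suc p N.≤ p N.+ N.suc q
      p≤ = NP.≤-trans (N.s≤s (NP.m≤m+n p q)) (NP.≤-reflexive (P.sym (NP.+-suc p q)))

  length-split : ∀ as (x : Step) bs (y : Step) cs →
    length (as ++ₗ x ∷ (bs ++ₗ y ∷ cs)) ≡ length (x ∷ bs) N.+ length (as ++ₗ y ∷ cs)
  length-split as x bs y cs = begin
    length (as ++ₗ x ∷ (bs ++ₗ y ∷ cs))
      ≡⟨ LP.length-++ as ⟩
    length as N.+ N.suc (length (bs ++ₗ y ∷ cs))
      ≡⟨ P.cong (λ l → length as N.+ N.suc l) (LP.length-++ bs) ⟩
    length as N.+ N.suc (length bs N.+ N.suc (length cs))
      ≡⟨ rearrange (length as) (length bs) (length cs) ⟩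
    N.suc (length bs) N.+ (length as N.+ N.suc (length cs))
      ≡⟨ P.cong (N.suc (length bs) N.+_) (P.sym (LP.length-++ as)) ⟩
    length (x ∷ bs) N.+ length (as ++ₗ y ∷ cs) ∎
    where
      open P.≡-Reasoning
      rearrange : ∀ a b c → a N.+ N.suc (b N.+ N.suc c) ≡ N.suc b N.+ (a N.+ N.suc c)
      rearrange = NatSolver.solve-∀

  cut-closed-walk : ∀ as x bs y cs {u} → IsWalk u u (as ++ₗ x ∷ (bs ++ₗ y ∷ cs)) → from x ≡ from y →
    IsWalk (from x) (from x) (x ∷ bs) × IsWalk u u (as ++ₗ y ∷ cs)
  cut-closed-walk as x bs y cs p from≡ with walk-split as x (bs ++ₗ y ∷ cs) p
  ... | before , fromX with walk-split (x ∷ bs) y cs fromX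
  ... | loop , fromY =
    walk-subst (x ∷ bs) P.refl (P.sym from≡) loop ,
    walk-++ as before (walk-subst (y ∷ cs) (P.sym from≡) P.refl fromY)

  colour-cut : ∀ as x bs y cs → walkColour (as ++ₗ x ∷ (bs ++ₗ y ∷ cs)) ≡
    walkColour (x ∷ bs) +² walkColour (as ++ₗ y ∷ cs)
  colour-cut as x bs y cs = begin
    walkColour (as ++ₗ x ∷ (bs ++ₗ y ∷ cs))
      ≡⟨ walkColour-++ as (x ∷ (bs ++ₗ y ∷ cs)) ⟩
    walkColour as +² walkColour ((x ∷ bs) ++ₗ y ∷ cs)
      ≡⟨ P.cong (walkColour as +²_) (walkColour-++ (x ∷ bs) (y ∷ cs)) ⟩
    walkColour as +² (walkColour (x ∷ bs) +² walkColour (y ∷ cs))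
      ≡⟨ +²-exchange (walkColour as) (walkColour (x ∷ bs)) (walkColour (y ∷ cs)) ⟩
    walkColour (x ∷ bs) +² (walkColour as +² walkColour (y ∷ cs))
      ≡⟨ P.cong (walkColour (x ∷ bs) +²_) (P.sym (walkColour-++ as (y ∷ cs))) ⟩
    walkColour (x ∷ bs) +² walkColour (as ++ₗ y ∷ cs) ∎
    where open P.≡-Reasoning

  closed-walk∈Γ-bounded : ∀ k ss {u} → length ss N.≤ k → IsWalk u u ss → Γ (walkColour ss)
  closed-walk∈Γ-bounded k [] _ _ = Γ-0
  closed-walk∈Γ-bounded (N.suc k) (s ∷ ss) {u} short p
    with repetition-or-distinct from Fin._≟_ (s ∷ ss)
  ... | inj₁ (as , bs , cs , x , y , ss≡ , from≡) =
    P.subst (Γ ∘ walkColour) (P.sym ss≡) (P.subst Γ (P.sym (colour-cut as x bs y cs))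
      (Γ-+ (closed-walk∈Γ-bounded k (x ∷ bs) (proj₁ shorter) (proj₁ pieces))
           (closed-walk∈Γ-bounded k (as ++ₗ y ∷ cs) (proj₂ shorter) (proj₂ pieces))))
    where
      pieces : IsWalk (from x) (from x) (x ∷ bs) × IsWalk u u (as ++ₗ y ∷ cs)
      pieces = cut-closed-walk as x bs y cs (P.subst (IsWalk u u) ss≡ p) from≡
      shorter : (length (x ∷ bs) N.≤ k) × (length (as ++ₗ y ∷ cs) N.≤ k)
      shorter = pieces-shorter
        (P.subst (N._≤ N.suc k) (P.trans (P.cong length ss≡) (length-split as x bs y cs)) short)
        (N.s≤s N.z≤n) (NP.<-≤-trans (N.s≤s N.z≤n) (LP.length-++-≤ʳ (y ∷ cs) {as}))
  ... | inj₂ distinctVertices with repetition-or-distinct proj₁ Fin._≟_ (s ∷ ss)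
  ...   | inj₁ (as , bs , cs , x , y , ss≡ , edge≡) =
    P.subst (Γ ∘ walkColour) (P.sym ss≡)
      (P.subst Γ (P.sym (repeated-edge as x bs y cs (P.subst (DistinctBy from) ss≡ distinctVertices)
                                                    (P.subst (IsWalk u u) ss≡ p) edge≡)) Γ-0)
  ...   | inj₂ distinctEdges with simple-cycle s ss p distinctVertices distinctEdges
  ...     | C , ρC≡ = P.subst Γ ρC≡ (Γ-cycle C)

  closed-walk∈Γ : ∀ ss {u} → IsWalk u u ss → Γ (walkColour ss)
  closed-walk∈Γ ss = closed-walk∈Γ-bounded (length ss) ss NP.≤-refl

-- The unknowns of P(G, γ, d) are the coordinates p_{v,a} and the entries
-- L_{ab}; a linear functional of (p, L) is its coefficient vector in V.  The
-- functional gap u w g a : (p, L) ↦ p_{u,a} − p_{w,a} − (L g)_a measures the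
-- failure of "p_u = p_w + L g", and a solution is collapsed exactly when the
-- gaps of all edges vanish.
module Functionals (ℝ : RealNumbers) (n : ℕ) where
  open RealFacts ℝ

  Unknowns : Set
  Unknowns = (Fin n × Fin 2) ⊎ (Fin 2 × Fin 2)

  open LinearAlgebra ℝ Unknowns public

  ℤ²R : ℤ² → Fin 2 → Carrier
  ℤ²R = ℤ²→ℝ² ℝ

  point : Fin n → Fin 2 → V
  point u a (inj₁ (v , b)) = δ u v * δ a b
  point u a (inj₂ _) = 0#

  entry : Fin 2 → Fin 2 → V
  entry a b (inj₁ _) = 0#
  entry a b (inj₂ (a' , b')) = δ a a' * δ b b'

  matrixTimes : ℤ² → Fin 2 → V
  matrixTimes g a = lin (ℤ²R g) (entry a)

  gap : Fin n → Fin n → ℤ² → Fin 2 → V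
  gap u w g a = (point u a -V point w a) -V matrixTimes g a

  gap-loop : ∀ u g a → gap u u g a ≋ 0V -V matrixTimes g a
  gap-loop u g a x = solve 2 (λ v w → (v :- v) :- w := con (+ 0) :- w) refl _ _

  matrixTimes-+ : ∀ g h a → matrixTimes (g +² h) a ≋ matrixTimes g a +V matrixTimes h a
  matrixTimes-+ (g₀ , g₁) (h₀ , h₁) a x = begin
    ℤR (g₀ ℤ.+ h₀) * e₀ + (ℤR (g₁ ℤ.+ h₁) * e₁ + 0#)
      ≈⟨ +-cong (*-congʳ (ℤR-+ g₀ h₀)) (+-congʳ (*-congʳ (ℤR-+ g₁ h₁))) ⟩
    (ℤR g₀ + ℤR h₀) * e₀ + ((ℤR g₁ + ℤR h₁) * e₁ + 0#)
      ≈⟨ solve 6 (λ a b c d e f → (a :+ b) :* e :+ ((c :+ d) :* f :+ con (+ 0))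
                   := (a :* e :+ (c :* f :+ con (+ 0))) :+ (b :* e :+ (d :* f :+ con (+ 0)))) refl _ _ _ _ _ _ ⟩
    (ℤR g₀ * e₀ + (ℤR g₁ * e₁ + 0#)) + (ℤR h₀ * e₀ + (ℤR h₁ * e₁ + 0#)) ∎
    where
      e₀ e₁ : Carrier
      e₀ = entry a Fin.zero x
      e₁ = entry a (Fin.suc Fin.zero) x

  matrixTimes-neg : ∀ g a → matrixTimes (-² g) a ≋ 0V -V matrixTimes g a
  matrixTimes-neg (g₀ , g₁) a x = begin
    ℤR (ℤ.- g₀) * e₀ + (ℤR (ℤ.- g₁) * e₁ + 0#)
      ≈⟨ +-cong (*-congʳ (ℤR-neg g₀)) (+-congʳ (*-congʳ (ℤR-neg g₁))) ⟩
    (- ℤR g₀) * e₀ + ((- ℤR g₁) * e₁ + 0#)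
      ≈⟨ solve 4 (λ a b e f → (:- a) :* e :+ ((:- b) :* f :+ con (+ 0))
                   := con (+ 0) :- (a :* e :+ (b :* f :+ con (+ 0)))) refl _ _ _ _ ⟩
    0# - (ℤR g₀ * e₀ + (ℤR g₁ * e₁ + 0#)) ∎
    where
      e₀ e₁ : Carrier
      e₀ = entry a Fin.zero x
      e₁ = entry a (Fin.suc Fin.zero) x

  matrixTimes-0 : ∀ a → matrixTimes 0² a ≋ 0V
  matrixTimes-0 a x = solve 2 (λ e f → con (+ 0) :* e :+ (con (+ 0) :* f :+ con (+ 0)) := con (+ 0)) refl _ _

  -- Going around a triangle: if r is joined to s and t with colours gs and gt,
  -- the gap of s and t is the difference of their gaps to r, up to the colour
  -- gs + g − gt of the loop r → s → t → r.
  gap-triangle : ∀ r s t g gs gt a →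
    gap s t g a ≋ (gap r t gt a -V gap r s gs a) -V matrixTimes (gs +² (g +² (-² gt))) a
  gap-triangle r s t g gs gt a x = begin
    (point s a x - point t a x) - matrixTimes g a x
      ≈⟨ solve 6 (λ Ps Pt Pr Mg Mgs Mgt → (Ps :- Pt) :- Mg
                   := ((Pr :- Pt) :- Mgt :- ((Pr :- Ps) :- Mgs)) :- (Mgs :+ (Mg :+ (con (+ 0) :- Mgt))))
              refl _ _ (point r a x) _ (matrixTimes gs a x) (matrixTimes gt a x) ⟩
    (gap r t gt a x - gap r s gs a x) - (matrixTimes gs a x + (matrixTimes g a x + (0# - matrixTimes gt a x)))
      ≈⟨ +-congˡ (-‿cong (sym (trans (matrixTimes-+ gs (g +² (-² gt)) a x)
           (+-congˡ (trans (matrixTimes-+ g (-² gt) a x) (+-congˡ (matrixTimes-neg gt a x))))))) ⟩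
    (gap r t gt a x - gap r s gs a x) - matrixTimes (gs +² (g +² (-² gt))) a x ∎

  ⟪_,_⟫ : ∀ {k l} → (Fin k → Fin l → Carrier) → (Fin k → Fin l → Carrier) → Carrier
  ⟪ φ , x ⟫ = Σᵣ ℝ (λ i → Σᵣ ℝ (λ j → φ i j * x i j))

  ⟪⟫-cong : ∀ {k l} (φ ψ x : Fin k → Fin l → Carrier) → (∀ i j → φ i j ≈ ψ i j) → ⟪ φ , x ⟫ ≈ ⟪ ψ , x ⟫
  ⟪⟫-cong φ ψ x φ≈ψ = Σ-cong (λ i → Σ-cong (λ j → *-congʳ (φ≈ψ i j)))

  ⟪⟫-+ : ∀ {k l} (φ ψ x : Fin k → Fin l → Carrier) → ⟪ (λ i j → φ i j + ψ i j) , x ⟫ ≈ ⟪ φ , x ⟫ + ⟪ ψ , x ⟫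
  ⟪⟫-+ φ ψ x = trans (Σ-cong (λ i → trans (Σ-cong (λ j → distribʳ (x i j) (φ i j) (ψ i j)))
                                          (Σ-+ (λ j → φ i j * x i j) (λ j → ψ i j * x i j))))
                     (Σ-+ (λ i → Σᵣ ℝ (λ j → φ i j * x i j)) (λ i → Σᵣ ℝ (λ j → ψ i j * x i j)))

  ⟪⟫-· : ∀ {k l} c (φ x : Fin k → Fin l → Carrier) → ⟪ (λ i j → c * φ i j) , x ⟫ ≈ c * ⟪ φ , x ⟫
  ⟪⟫-· c φ x = trans (Σ-cong (λ i → trans (Σ-cong (λ j → *-assoc c (φ i j) (x i j)))
                                          (Σ-* c (λ j → φ i j * x i j))))
                     (Σ-* c (λ i → Σᵣ ℝ (λ j → φ i j * x i j)))

  ⟪⟫-0 : ∀ {k l} (x : Fin k → Fin l → Carrier) → ⟪ (λ _ _ → 0#) , x ⟫ ≈ 0#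
  ⟪⟫-0 x = Σ-0 _ (λ i → Σ-0 (λ j → 0# * x i j) (λ j → zeroˡ _))

  ⟪⟫-δδ : ∀ {k l} (u : Fin k) (a : Fin l) x → ⟪ (λ i j → δ u i * δ a j) , x ⟫ ≈ x u a
  ⟪⟫-δδ u a x = begin
    Σᵣ ℝ (λ i → Σᵣ ℝ (λ j → (δ u i * δ a j) * x i j))
      ≈⟨ Σ-cong (λ i → trans (Σ-cong (λ j → *-assoc (δ u i) (δ a j) (x i j))) (Σ-* (δ u i) (λ j → δ a j * x i j))) ⟩
    Σᵣ ℝ (λ i → δ u i * Σᵣ ℝ (λ j → δ a j * x i j))   ≈⟨ Σ-δ u _ ⟩
    Σᵣ ℝ (λ j → δ a j * x u j)                          ≈⟨ Σ-δ a _ ⟩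
    x u a                                               ∎

  module Evaluation (p : Fin n → ℝ² ℝ) (L : Mat2 ℝ) where

    onP : V → Fin n → Fin 2 → Carrier
    onP φ v b = φ (inj₁ (v , b))

    onL : V → Fin 2 → Fin 2 → Carrier
    onL φ a b = φ (inj₂ (a , b))

    ev : V → Carrier
    ev φ = ⟪ onP φ , p ⟫ + ⟪ onL φ , L ⟫

    ev-cong : ∀ {φ ψ} → φ ≋ ψ → ev φ ≈ ev ψ
    ev-cong {φ} {ψ} φ≋ψ = +-cong (⟪⟫-cong (onP φ) (onP ψ) p (λ _ _ → φ≋ψ _))
                                 (⟪⟫-cong (onL φ) (onL ψ) L (λ _ _ → φ≋ψ _))

    ev-0 : ev 0V ≈ 0#
    ev-0 = trans (+-cong (⟪⟫-0 p) (⟪⟫-0 L)) (+-identityˡ _)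

    ev-+ : ∀ φ ψ → ev (φ +V ψ) ≈ ev φ + ev ψ
    ev-+ φ ψ = trans (+-cong (⟪⟫-+ (onP φ) (onP ψ) p) (⟪⟫-+ (onL φ) (onL ψ) L))
                     (solve 4 (λ a b c d → (a :+ b) :+ (c :+ d) := (a :+ c) :+ (b :+ d)) refl _ _ _ _)

    ev-· : ∀ c φ → ev (c ·V φ) ≈ c * ev φ
    ev-· c φ = trans (+-cong (⟪⟫-· c (onP φ) p) (⟪⟫-· c (onL φ) L)) (sym (distribˡ _ _ _))

    ev-- : ∀ φ ψ → ev (φ -V ψ) ≈ ev φ - ev ψ
    ev-- φ ψ = trans (ev-cong {φ -V ψ} {φ +V (- 1#) ·V ψ} (λ x → +-congˡ (sym (-1*x≈-x _))))
                     (trans (ev-+ φ ((- 1#) ·V ψ)) (+-congˡ (trans (ev-· (- 1#) ψ) (-1*x≈-x _))))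

    ev-span : ∀ {S : V → Set} → (∀ φ → S φ → ev φ ≈ 0#) → ∀ {φ} → Span S φ → ev φ ≈ 0#
    ev-span onS (gen s) = onS _ s
    ev-span onS span-0 = ev-0
    ev-span onS (span-+ {φ} {ψ} s t) = trans (ev-+ φ ψ) (trans (+-cong (ev-span onS s) (ev-span onS t)) (+-identityʳ _))
    ev-span onS (span-· {φ} c s) = trans (ev-· c φ) (trans (*-congˡ (ev-span onS s)) (zeroʳ _))
    ev-span onS (span-≋ {φ} {ψ} φ≋ψ s) = trans (sym (ev-cong φ≋ψ)) (ev-span onS s)

    ev-point : ∀ u a → ev (point u a) ≈ p u a
    ev-point u a = trans (+-cong (⟪⟫-δδ u a p) (⟪⟫-0 L)) (+-identityʳ _)

    ev-entry : ∀ a b → ev (entry a b) ≈ L a b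
    ev-entry a b = trans (+-cong (⟪⟫-0 p) (⟪⟫-δδ a b L)) (+-identityˡ _)

    ev-lin : ∀ {k} (c : Fin k → Carrier) (B : Fin k → V) → ev (lin c B) ≈ Σᵣ ℝ (λ i → c i * ev (B i))
    ev-lin {N.zero} c B = trans (ev-cong {lin c B} {0V} (λ _ → refl)) ev-0
    ev-lin {N.suc k} c B = begin
      ev (lin c B)
        ≈⟨ ev-cong {lin c B} {c Fin.zero ·V B Fin.zero +V lin c' B'} (λ _ → refl) ⟩
      ev (c Fin.zero ·V B Fin.zero +V lin c' B')       ≈⟨ ev-+ (c Fin.zero ·V B Fin.zero) (lin c' B') ⟩
      ev (c Fin.zero ·V B Fin.zero) + ev (lin c' B')   ≈⟨ +-cong (ev-· (c Fin.zero) (B Fin.zero)) (ev-lin c' B') ⟩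
      c Fin.zero * ev (B Fin.zero) + Σᵣ ℝ (λ i → c' i * ev (B' i)) ∎
      where
        c' : Fin k → Carrier
        c' i = c (Fin.suc i)
        B' : Fin k → V
        B' i = B (Fin.suc i)

    ev-matrixTimes : ∀ g a → ev (matrixTimes g a) ≈ (_⊙_ ℝ L (ℤ²R g)) a
    ev-matrixTimes (g₀ , g₁) a = begin
      ev (matrixTimes (g₀ , g₁) a)                    ≈⟨ ev-lin (ℤ²R (g₀ , g₁)) (entry a) ⟩
      ℤR g₀ * ev (entry a Fin.zero) + (ℤR g₁ * ev (entry a o) + 0#)
        ≈⟨ +-cong (*-congˡ (ev-entry a Fin.zero)) (+-congʳ (*-congˡ (ev-entry a o))) ⟩
      ℤR g₀ * L a Fin.zero + (ℤR g₁ * L a o + 0#)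
        ≈⟨ solve 4 (λ x y l m → x :* l :+ (y :* m :+ con (+ 0)) := l :* x :+ m :* y) refl _ _ _ _ ⟩
      L a Fin.zero * ℤR g₀ + L a o * ℤR g₁ ∎
      where
        o : Fin 2
        o = Fin.suc Fin.zero

    ev-gap : ∀ u w g a → ev (gap u w g a) ≈ p u a - (p w a + (_⊙_ ℝ L (ℤ²R g)) a)
    ev-gap u w g a = begin
      ev (gap u w g a)
        ≈⟨ trans (ev-- (point u a -V point w a) (matrixTimes g a)) (+-congʳ (ev-- (point u a) (point w a))) ⟩
      (ev (point u a) - ev (point w a)) - ev (matrixTimes g a)
        ≈⟨ +-cong (+-cong (ev-point u a) (-‿cong (ev-point w a))) (-‿cong (ev-matrixTimes g a)) ⟩
      (p u a - p w a) - (_⊙_ ℝ L (ℤ²R g)) a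
        ≈⟨ solve 3 (λ x y z → (x :- y) :- z := x :- (y :+ z)) refl _ _ _ ⟩
      p u a - (p w a + (_⊙_ ℝ L (ℤ²R g)) a) ∎

  matrixTimes-on-p : ∀ g a v b → matrixTimes g a (inj₁ (v , b)) ≈ 0#
  matrixTimes-on-p g a v b = Σ-0 (λ b' → ℤ²R g b' * 0#) (λ b' → zeroʳ _)

  matrixTimes-on-L : ∀ g a a' b' → matrixTimes g a (inj₂ (a' , b')) ≈ δ a a' * ℤ²R g b'
  matrixTimes-on-L g a a' b' = begin
    Σᵣ ℝ (λ b → ℤ²R g b * (δ a a' * δ b b'))
      ≈⟨ Σ-cong (λ b → solve 3 (λ x y z → x :* (y :* z) := y :* (x :* z)) refl (ℤ²R g b) (δ a a') (δ b b')) ⟩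
    Σᵣ ℝ (λ b → δ a a' * (ℤ²R g b * δ b b'))   ≈⟨ Σ-* (δ a a') (λ b → ℤ²R g b * δ b b') ⟩
    δ a a' * Σᵣ ℝ (λ b → ℤ²R g b * δ b b')     ≈⟨ *-congˡ (Σ-δʳ b' (ℤ²R g)) ⟩
    δ a a' * ℤ²R g b'                          ∎

  weighted-gap-on-p : ∀ (D : Fin 2 → Carrier) u w g v b →
    lin D (gap u w g) (inj₁ (v , b)) ≈ (δ u v - δ w v) * D b
  weighted-gap-on-p D u w g v b = begin
    Σᵣ ℝ (λ a → D a * (((δ u v * δ a b) - (δ w v * δ a b)) - matrixTimes g a (inj₁ (v , b))))
      ≈⟨ Σ-cong (λ a → trans (*-congˡ (+-congˡ (-‿cong (matrixTimes-on-p g a v b))))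
           (solve 5 (λ D x y z o → D :* ((x :* y :- z :* y) :- o) := (x :- z) :* (D :* y) :- D :* o)
                  refl (D a) (δ u v) (δ a b) (δ w v) 0#)) ⟩
    Σᵣ ℝ (λ a → (δ u v - δ w v) * (D a * δ a b) - D a * 0#)
      ≈⟨ Σ-cong {g = λ a → (δ u v - δ w v) * (D a * δ a b)}
           (λ a → trans (+-congˡ (-‿cong (zeroʳ (D a)))) (trans (+-congˡ -0#≈0#) (+-identityʳ _))) ⟩
    Σᵣ ℝ (λ a → (δ u v - δ w v) * (D a * δ a b))
      ≈⟨ Σ-* (δ u v - δ w v) (λ a → D a * δ a b) ⟩
    (δ u v - δ w v) * Σᵣ ℝ (λ a → D a * δ a b)   ≈⟨ *-congˡ (Σ-δʳ b D) ⟩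
    (δ u v - δ w v) * D b                         ∎

  weighted-gap-on-L : ∀ (D : Fin 2 → Carrier) u w g a' b' →
    lin D (gap u w g) (inj₂ (a' , b')) ≈ 0# - D a' * ℤ²R g b'
  weighted-gap-on-L D u w g a' b' = begin
    Σᵣ ℝ (λ a → D a * ((0# - 0#) - matrixTimes g a (inj₂ (a' , b'))))
      ≈⟨ Σ-cong (λ a → trans (*-congˡ (+-congˡ (-‿cong (matrixTimes-on-L g a a' b'))))
           (solve 4 (λ D x y z → D :* ((z :- z) :- x :* y) := (con (+ 0) :- y) :* (D :* x))
                  refl (D a) (δ a a') (ℤ²R g b') 0#)) ⟩
    Σᵣ ℝ (λ a → (0# - ℤ²R g b') * (D a * δ a a'))   ≈⟨ Σ-* (0# - ℤ²R g b') (λ a → D a * δ a a') ⟩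
    (0# - ℤ²R g b') * Σᵣ ℝ (λ a → D a * δ a a')     ≈⟨ *-congˡ (Σ-δʳ a' D) ⟩
    (0# - ℤ²R g b') * D a'
      ≈⟨ solve 2 (λ g x → (con (+ 0) :- g) :* x := con (+ 0) :- x :* g) refl (ℤ²R g b') (D a') ⟩
    0# - D a' * ℤ²R g b'                            ∎

  -- Each row of P is a combination of the gaps of its edge:
  --   ⟨p_t + L γ − p_s , D⟩ = − Σ_a D_a (p_s − p_t − L γ)_a   with D = d_e^⊥.
  module Rows {m : ℕ} (G : ColoredGraph n m) (d : Fin m → ℝ² ℝ) where

    collapse : Fin m → Fin 2 → V
    collapse e = gap (src G e) (tgt G e) (col G e)

    row-decomposition : ∀ e → coeff ℝ G d e ≋ 0V -V lin (_⊥ ℝ (d e)) (collapse e)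
    row-decomposition e (inj₁ (v , b)) = begin
      (if ⌊ v Fin.≟ t ⌋ then D b else 0#) - (if ⌊ v Fin.≟ s ⌋ then D b else 0#)
        ≈⟨ +-cong (sym (δ-select t v (D b))) (-‿cong (sym (δ-select s v (D b)))) ⟩
      δ t v * D b - δ s v * D b
        ≈⟨ solve 3 (λ x y z → x :* z :- y :* z := con (+ 0) :- (y :- x) :* z) refl (δ t v) (δ s v) (D b) ⟩
      0# - (δ s v - δ t v) * D b
        ≈⟨ +-congˡ (-‿cong (sym (weighted-gap-on-p D s t (col G e) v b))) ⟩
      0# - lin D (collapse e) (inj₁ (v , b)) ∎
      where
        s t : Fin n
        s = src G e
        t = tgt G e
        D : Fin 2 → Carrier
        D = _⊥ ℝ (d e)
    row-decomposition e (inj₂ (a , b)) = begin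
      D a * ℤ²R (col G e) b
        ≈⟨ solve 1 (λ x → x := con (+ 0) :- (con (+ 0) :- x)) refl (D a * ℤ²R (col G e) b) ⟩
      0# - (0# - D a * ℤ²R (col G e) b)
        ≈⟨ +-congˡ (-‿cong (sym (weighted-gap-on-L D (src G e) (tgt G e) (col G e) a b))) ⟩
      0# - lin D (collapse e) (inj₂ (a , b)) ∎
      where
        D : Fin 2 → Carrier
        D = _⊥ ℝ (d e)

    module _ (p : Fin n → ℝ² ℝ) (L : Mat2 ℝ) where
      open Evaluation p L

      ev-row : IsSolution ℝ G d p L → ∀ e → ev (coeff ℝ G d e) ≈ 0#
      ev-row solution e = begin
        ev (coeff ℝ G d e)
          ≈⟨ ev-cong (row-decomposition e) ⟩
        ev (0V -V lin D (collapse e))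
          ≈⟨ trans (ev-- 0V (lin D (collapse e))) (+-cong ev-0 (-‿cong (ev-lin D (collapse e)))) ⟩
        0# - (D₀ * ev (collapse e Fin.zero) + (D₁ * ev (collapse e o) + 0#))
          ≈⟨ +-congˡ (-‿cong (+-cong (*-congˡ (ev-gap s t γ Fin.zero)) (+-congʳ (*-congˡ (ev-gap s t γ o))))) ⟩
        0# - (D₀ * (p s Fin.zero - (p t Fin.zero + Lγ Fin.zero)) + (D₁ * (p s o - (p t o + Lγ o)) + 0#))
          ≈⟨ solve 8 (λ d₀ d₁ s₀ s₁ t₀ t₁ m₀ m₁ →
                 con (+ 0) :- (d₀ :* (s₀ :- (t₀ :+ m₀)) :+ (d₁ :* (s₁ :- (t₁ :+ m₁)) :+ con (+ 0)))
                 := ((t₀ :+ m₀) :- s₀) :* d₀ :+ ((t₁ :+ m₁) :- s₁) :* d₁) refl _ _ _ _ _ _ _ _ ⟩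
        ((p t Fin.zero + Lγ Fin.zero) - p s Fin.zero) * D₀ + ((p t o + Lγ o) - p s o) * D₁
          ≈⟨ solution e ⟩
        0# ∎
        where
          s t : Fin n
          s = src G e
          t = tgt G e
          γ : ℤ²
          γ = col G e
          o : Fin 2
          o = Fin.suc Fin.zero
          D Lγ : Fin 2 → Carrier
          D = _⊥ ℝ (d e)
          Lγ = _⊙_ ℝ L (ℤ²R γ)
          D₀ D₁ : Carrier
          D₀ = D Fin.zero
          D₁ = D o

      collapsed-if-gaps-vanish : (∀ e a → ev (collapse e a) ≈ 0#) → IsCollapsed ℝ G d p L
      collapsed-if-gaps-vanish vanish e a = begin
        p (src G e) a                                 ≈⟨ solve 2 (λ x y → x := (x :- y) :+ y) refl _ _ ⟩
        (p (src G e) a - q) + q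
          ≈⟨ +-congʳ (trans (sym (ev-gap (src G e) (tgt G e) (col G e) a)) (vanish e a)) ⟩
        0# + q                                        ≈⟨ +-identityˡ q ⟩
        q                                             ∎
        where
          q : Carrier
          q = p (tgt G e) a + _⊙_ ℝ L (ℤ²R (col G e)) a

det : ℤ² → ℤ² → ℤ
det (a , b) (c , e) = a ℤ.* e ℤ.- b ℤ.* c

pair : ℤ² → ℤ² → Fin 2 → ℤ²
pair v h Fin.zero = v
pair v h (Fin.suc _) = h

-- Cramer's rule: the coefficients of α v + β h, times det v h
cramer₀ : ∀ α β v₁ v₂ h₁ h₂ →
  α ℤ.* (v₁ ℤ.* h₂ ℤ.- v₂ ℤ.* h₁) ≡
  h₂ ℤ.* (α ℤ.* v₁ ℤ.+ (β ℤ.* h₁ ℤ.+ + 0)) ℤ.- h₁ ℤ.* (α ℤ.* v₂ ℤ.+ (β ℤ.* h₂ ℤ.+ + 0))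
cramer₀ = solve-∀

cramer₁ : ∀ α β v₁ v₂ h₁ h₂ →
  β ℤ.* (v₁ ℤ.* h₂ ℤ.- v₂ ℤ.* h₁) ≡
  v₁ ℤ.* (α ℤ.* v₂ ℤ.+ (β ℤ.* h₂ ℤ.+ + 0)) ℤ.- v₂ ℤ.* (α ℤ.* v₁ ℤ.+ (β ℤ.* h₁ ℤ.+ + 0))
cramer₁ = solve-∀

·0-·0 : ∀ x y → x ℤ.* + 0 ℤ.- y ℤ.* + 0 ≡ + 0
·0-·0 = solve-∀

cancel-nonzero : ∀ a x → ¬ (x ≡ + 0) → a ℤ.* x ≡ + 0 → a ≡ + 0
cancel-nonzero a x x≢0 ax≡0 with ZP.i*j≡0⇒i≡0∨j≡0 a ax≡0
... | inj₁ a≡0 = a≡0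
... | inj₂ x≡0 = ⊥-elim (x≢0 x≡0)

module IntegerIndependence {n m : ℕ} (G : ColoredGraph n m) where

  independent-pair : ∀ v h → ¬ (det v h ≡ + 0) → Independent G (pair v h)
  independent-pair (v₁ , v₂) (h₁ , h₂) det≢0 a combination≡0 = λ
    { Fin.zero → cancel-nonzero α _ det≢0 (P.trans (cramer₀ α β v₁ v₂ h₁ h₂)
         (P.trans (P.cong₂ (λ x y → h₂ ℤ.* x ℤ.- h₁ ℤ.* y) first second) (·0-·0 h₂ h₁)))
    ; (Fin.suc Fin.zero) → cancel-nonzero β _ det≢0 (P.trans (cramer₁ α β v₁ v₂ h₁ h₂)
         (P.trans (P.cong₂ (λ x y → v₁ ℤ.* x ℤ.- v₂ ℤ.* y) second first) (·0-·0 v₁ v₂))) }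
    where
      α β : ℤ
      α = a Fin.zero
      β = a (Fin.suc Fin.zero)
      first : α ℤ.* v₁ ℤ.+ (β ℤ.* h₁ ℤ.+ + 0) ≡ + 0
      first = P.cong proj₁ combination≡0
      second : α ℤ.* v₂ ℤ.+ (β ℤ.* h₂ ℤ.+ + 0) ≡ + 0
      second = P.cong proj₂ combination≡0

  independent-single : ∀ h → ¬ (h ≡ 0²) → Independent G (λ (_ : Fin 1) → h)
  independent-single (h₁ , h₂) h≢0 a combination≡0 Fin.zero
    with ZP.i*j≡0⇒i≡0∨j≡0 (a Fin.zero) (P.trans (P.sym (ZP.+-identityʳ _)) (P.cong proj₁ combination≡0))
  ... | inj₁ a≡0 = a≡0
  ... | inj₂ h₁≡0 with ZP.i*j≡0⇒i≡0∨j≡0 (a Fin.zero) (P.trans (P.sym (ZP.+-identityʳ _)) (P.cong proj₂ combination≡0))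
  ...   | inj₁ a≡0 = a≡0
  ...   | inj₂ h₂≡0 = ⊥-elim (h≢0 (pair≡ h₁≡0 h₂≡0))

  independent⇒nonzero : (vs : Fin 1 → ℤ²) → Independent G vs → ¬ (vs Fin.zero ≡ 0²)
  independent⇒nonzero vs indep v≡0 with indep (λ _ → + 1) (P.trans (·²-identity (vs Fin.zero)) v≡0) Fin.zero
  ... | ()

  _≟0² : ∀ h → Dec (h ≡ 0²)
  (h₁ , h₂) ≟0² with h₁ ℤ.≟ + 0 | h₂ ℤ.≟ + 0
  ... | yes h₁≡0 | yes h₂≡0 = yes (pair≡ h₁≡0 h₂≡0)
  ... | no h₁≢0 | _ = no λ h≡0 → h₁≢0 (P.cong proj₁ h≡0)
  ... | yes _ | no h₂≢0 = no λ h≡0 → h₂≢0 (P.cong proj₂ h≡0)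

-- Since rk Γ = k, the functionals (p, L) ↦ (L h)_a for h ∈ Γ lie in the span
-- of at most 2k functionals: none are needed if Γ = 0, the two functionals
-- (L v)_a for a generator direction v if k = 1, and the four entries of L
-- otherwise.
module CycleFunctionals (ℝ : RealNumbers) {n m : ℕ} (G : ColoredGraph n m) where
  open RealFacts ℝ
  open Functionals ℝ n
  open ClosedWalks G using (Γ)
  open IntegerIndependence G

  record CycleSpan (k : ℕ) : Set where
    field
      size : ℕ
      functionals : Fin size → V
      size-bound : size N.≤ 2 N.* k
      spans : ∀ h → Γ h → ∀ a → Span (Among functionals) (matrixTimes h a)

  allEntries : Fin 4 → V
  allEntries Fin.zero = entry Fin.zero Fin.zero
  allEntries (Fin.suc Fin.zero) = entry Fin.zero (Fin.suc Fin.zero)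
  allEntries (Fin.suc (Fin.suc Fin.zero)) = entry (Fin.suc Fin.zero) Fin.zero
  allEntries (Fin.suc (Fin.suc (Fin.suc Fin.zero))) = entry (Fin.suc Fin.zero) (Fin.suc Fin.zero)

  entry∈allEntries : ∀ a b → Among allEntries (entry a b)
  entry∈allEntries Fin.zero Fin.zero = Fin.zero , λ x → refl
  entry∈allEntries Fin.zero (Fin.suc Fin.zero) = Fin.suc Fin.zero , λ x → refl
  entry∈allEntries (Fin.suc Fin.zero) Fin.zero = Fin.suc (Fin.suc Fin.zero) , λ x → refl
  entry∈allEntries (Fin.suc Fin.zero) (Fin.suc Fin.zero) = Fin.suc (Fin.suc (Fin.suc Fin.zero)) , λ x → refl

  proportional : ∀ {H₁ H₂ V₁ V₂ y} x z → V₁ * y ≈ 1# → V₁ * H₂ ≈ V₂ * H₁ →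
    H₁ * x + (H₂ * z + 0#) ≈ (y * H₁) * (V₁ * x + (V₂ * z + 0#))
  proportional {H₁} {H₂} {V₁} {V₂} {y} x z inverse parallel = sym (begin
    (y * H₁) * (V₁ * x + (V₂ * z + 0#))
      ≈⟨ solve 7 (λ y H₁ H₂ V₁ V₂ x z → (y :* H₁) :* (V₁ :* x :+ (V₂ :* z :+ con (+ 0)))
                   := (V₁ :* y) :* (H₁ :* x) :+ (y :* z) :* (V₂ :* H₁)) refl y H₁ H₂ V₁ V₂ x z ⟩
    (V₁ * y) * (H₁ * x) + (y * z) * (V₂ * H₁)   ≈⟨ +-congˡ (*-congˡ (sym parallel)) ⟩
    (V₁ * y) * (H₁ * x) + (y * z) * (V₁ * H₂)
      ≈⟨ solve 7 (λ y H₁ H₂ V₁ x z o → (V₁ :* y) :* (H₁ :* x) :+ (y :* z) :* (V₁ :* H₂)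
                   := (V₁ :* y) :* (H₁ :* x) :+ ((V₁ :* y) :* (H₂ :* z) :+ con (+ 0))) refl y H₁ H₂ V₁ x z 0# ⟩
    (V₁ * y) * (H₁ * x) + ((V₁ * y) * (H₂ * z) + 0#)
      ≈⟨ +-cong (*-congʳ inverse) (+-congʳ (*-congʳ inverse)) ⟩
    1# * (H₁ * x) + (1# * (H₂ * z) + 0#)       ≈⟨ +-cong (*-identityˡ _) (+-congʳ (*-identityˡ _)) ⟩
    H₁ * x + (H₂ * z + 0#)                     ∎)

  proportional′ : ∀ {H₁ H₂ V₁ V₂ y} x z → V₂ * y ≈ 1# → V₁ * H₂ ≈ V₂ * H₁ →
    H₁ * x + (H₂ * z + 0#) ≈ (y * H₂) * (V₁ * x + (V₂ * z + 0#))
  proportional′ {H₁} {H₂} {V₁} {V₂} {y} x z inverse parallel = begin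
    H₁ * x + (H₂ * z + 0#)               ≈⟨ swap (H₁ * x) (H₂ * z) ⟩
    H₂ * z + (H₁ * x + 0#)               ≈⟨ proportional z x inverse (sym parallel) ⟩
    (y * H₂) * (V₂ * z + (V₁ * x + 0#))  ≈⟨ *-congˡ (swap (V₂ * z) (V₁ * x)) ⟩
    (y * H₂) * (V₁ * x + (V₂ * z + 0#))  ∎
    where
      swap : ∀ a b → a + (b + 0#) ≈ b + (a + 0#)
      swap a b = solve 2 (λ a b → a :+ (b :+ con (+ 0)) := b :+ (a :+ con (+ 0))) refl a b

  det≡0⇒parallel : ∀ v₁ v₂ h₁ h₂ → det (v₁ , v₂) (h₁ , h₂) ≡ + 0 → ℤR v₁ * ℤR h₂ ≈ ℤR v₂ * ℤR h₁
  det≡0⇒parallel v₁ v₂ h₁ h₂ det≡0 =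
    trans (sym (ℤR-* v₁ h₂)) (trans (reflexive (P.cong ℤR (ZP.i-j≡0⇒i≡j (v₁ ℤ.* h₂) (v₂ ℤ.* h₁) det≡0))) (ℤR-* v₂ h₁))

  parallel-span : ∀ v → ¬ (v ≡ 0²) → ∀ h → det v h ≡ + 0 → ∀ a → Span (Among (matrixTimes v)) (matrixTimes h a)
  parallel-span (v₁ , v₂) v≢0 (h₁ , h₂) det≡0 a with v₁ ℤ.≟ + 0
  ... | no v₁≢0 = span-≋ (λ x → sym (proportional _ _ (proj₂ inv) (det≡0⇒parallel v₁ v₂ h₁ h₂ det≡0)))
                         (span-· (proj₁ inv * ℤR h₁) (gen (a , λ x → refl)))
    where inv = inverse (ℤR v₁) (λ v₁≈0 → v₁≢0 (ℤR≈0⇒≡0 v₁ v₁≈0))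
  ... | yes v₁≡0 = span-≋ (λ x → sym (proportional′ _ _ (proj₂ inv) (det≡0⇒parallel v₁ v₂ h₁ h₂ det≡0)))
                          (span-· (proj₁ inv * ℤR h₂) (gen (a , λ x → refl)))
    where inv = inverse (ℤR v₂) (λ v₂≈0 → v≢0 (pair≡ v₁≡0 (ℤR≈0⇒≡0 v₂ v₂≈0)))

  cycle-span : ∀ k → HasRank G Sub.⊤ k → CycleSpan k
  cycle-span N.zero (_ , maximal) =
    record { size = 0 ; functionals = none ; size-bound = N.z≤n ; spans = Γ-trivial }
    where
      none : Fin 0 → V
      none ()
      -- every h ∈ Γ is 0, since {h} would be an independent family of size 1
      Γ-trivial : ∀ h → Γ h → ∀ a → Span (Among none) (matrixTimes h a)
      Γ-trivial h h∈Γ a with h ≟0²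
      ... | yes P.refl = span-≋ (λ x → sym (matrixTimes-0 a x)) span-0
      ... | no h≢0 = ⊥-elim (maximal (λ _ → h) (λ _ → h∈Γ) (independent-single h h≢0))
  cycle-span (N.suc N.zero) ((vs , vs∈Γ , indep) , maximal) =
    record { size = 2 ; functionals = matrixTimes v ; size-bound = NP.≤-refl ; spans = Γ-line }
    where
      v : ℤ²
      v = vs Fin.zero
      -- every h ∈ Γ is parallel to v, since {v, h} cannot be independent
      Γ-line : ∀ h → Γ h → ∀ a → Span (Among (matrixTimes v)) (matrixTimes h a)
      Γ-line h h∈Γ a with det v h ℤ.≟ + 0
      ... | yes det≡0 = parallel-span v (independent⇒nonzero vs indep) h det≡0 a
      ... | no det≢0 = ⊥-elim (maximal (pair v h) (λ { Fin.zero → vs∈Γ Fin.zero ; (Fin.suc _) → h∈Γ })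
                                       (independent-pair v h det≢0))
  cycle-span (N.suc (N.suc k)) _ = record
    { size = 4 ; functionals = allEntries ; size-bound = NP.*-monoʳ-≤ 2 (N.s≤s (N.s≤s N.z≤n))
    ; spans = λ h _ a → lin∈span (ℤ²R h) (entry a) (λ b → gen (entry∈allEntries a b)) }

record Complement {c n : ℕ} (ρ : Fin c → Fin n) : Set where
  field
    size : ℕ
    enum : Fin size → Fin n
    size-bound : size N.+ c N.≤ n
    covers : ∀ v → (Σ (Fin size) λ i → enum i ≡ v) ⊎ (Σ (Fin c) λ j → ρ j ≡ v)

module RemoveFirst {c n} (ρ : Fin (N.suc c) → Fin (N.suc n)) (injective : ∀ i j → ρ i ≡ ρ j → i ≡ j) where

  ρ₀≢ : ∀ i → ¬ (ρ Fin.zero ≡ ρ (Fin.suc i))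
  ρ₀≢ i e with injective Fin.zero (Fin.suc i) e
  ... | ()

  ρ′ : Fin c → Fin n
  ρ′ i = Fin.punchOut (ρ₀≢ i)

  ρ′-injective : ∀ i j → ρ′ i ≡ ρ′ j → i ≡ j
  ρ′-injective i j e = FP.suc-injective (injective _ _ (FP.punchOut-injective (ρ₀≢ i) (ρ₀≢ j) e))

complement : ∀ {c n} (ρ : Fin c → Fin n) → (∀ i j → ρ i ≡ ρ j → i ≡ j) → Complement ρ
complement {N.zero} {n} ρ _ = record
  { size = n ; enum = λ v → v ; size-bound = NP.≤-reflexive (NP.+-identityʳ n) ; covers = λ v → inj₁ (v , P.refl) }
complement {N.suc c} {N.zero} ρ _ with ρ Fin.zero
... | ()
complement {N.suc c} {N.suc n} ρ injective = record
  { size = size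
  ; enum = λ i → Fin.punchIn ρ₀ (enum i)
  ; size-bound = NP.≤-trans (NP.≤-reflexive (NP.+-suc size c)) (N.s≤s size-bound)
  ; covers = covers′ }
  where
    open RemoveFirst ρ injective
    open Complement (complement ρ′ ρ′-injective)
    ρ₀ : Fin (N.suc n)
    ρ₀ = ρ Fin.zero
    covers′ : ∀ v → (Σ (Fin size) λ i → Fin.punchIn ρ₀ (enum i) ≡ v) ⊎ (Σ (Fin (N.suc c)) λ j → ρ j ≡ v)
    covers′ v with ρ₀ Fin.≟ v
    ... | yes ρ₀≡v = inj₂ (Fin.zero , ρ₀≡v)
    ... | no ρ₀≢v with covers (Fin.punchOut ρ₀≢v)
    ...   | inj₁ (i , enum≡) = inj₁ (i , P.trans (P.cong (Fin.punchIn ρ₀) enum≡) (FP.punchIn-punchOut ρ₀≢v))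
    ...   | inj₂ (j , ρ′j≡) = inj₂ (Fin.suc j , P.trans (P.sym (FP.punchIn-punchOut (ρ₀≢ j)))
              (P.trans (P.cong (Fin.punchIn ρ₀) ρ′j≡) (FP.punchIn-punchOut ρ₀≢v)))

edge-count : ∀ m n k c → (+ m) ≡ ((+ 2) ℤ.* (+ n) ℤ.+ (+ 2) ℤ.* (+ k) ℤ.- (+ 2) ℤ.* (+ c)) →
  m N.+ 2 N.* c ≡ 2 N.* n N.+ 2 N.* k
edge-count m n k c m≡ = ZP.+-injective (begin
  + (m N.+ 2 N.* c)                                             ≡⟨ ZP.pos-+ m (2 N.* c) ⟩
  + m ℤ.+ + (2 N.* c)                                           ≡⟨ P.cong₂ ℤ._+_ m≡ (ZP.pos-* 2 c) ⟩
  ((+ 2) ℤ.* (+ n) ℤ.+ (+ 2) ℤ.* (+ k) ℤ.- (+ 2) ℤ.* (+ c)) ℤ.+ (+ 2) ℤ.* (+ c)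
                                                                ≡⟨ minus-plus _ _ ⟩
  (+ 2) ℤ.* (+ n) ℤ.+ (+ 2) ℤ.* (+ k)                           ≡⟨ P.sym (P.cong₂ ℤ._+_ (ZP.pos-* 2 n) (ZP.pos-* 2 k)) ⟩
  + (2 N.* n) ℤ.+ + (2 N.* k)                                   ≡⟨ P.sym (ZP.pos-+ (2 N.* n) (2 N.* k)) ⟩
  + (2 N.* n N.+ 2 N.* k)                                       ∎)
  where
    open P.≡-Reasoning
    minus-plus : ∀ x y → (x ℤ.- y) ℤ.+ y ≡ x
    minus-plus = solve-∀

-- 2(n − c) potentials plus at most 2k cycle functionals: at most m generators
generator-bound : ∀ {t c n l k m} → t N.+ c N.≤ n → l N.≤ 2 N.* k → m N.+ 2 N.* c ≡ 2 N.* n N.+ 2 N.* k →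
  (t N.+ t) N.+ l N.≤ m
generator-bound {t} {c} {n} {l} {k} {m} t+c≤n l≤2k m≡ = NP.+-cancelʳ-≤ (2 N.* c) ((t N.+ t) N.+ l) m (begin
  (t N.+ t) N.+ l N.+ 2 N.* c ≡⟨ rearrange t c l ⟩
  2 N.* (t N.+ c) N.+ l       ≤⟨ NP.+-mono-≤ (NP.*-monoʳ-≤ 2 t+c≤n) l≤2k ⟩
  2 N.* n N.+ 2 N.* k         ≡⟨ P.sym m≡ ⟩
  m N.+ 2 N.* c               ∎)
  where
    open NP.≤-Reasoning
    rearrange : ∀ t c l → (t N.+ t) N.+ l N.+ 2 N.* c ≡ 2 N.* (t N.+ c) N.+ l
    rearrange = NatSolver.solve-∀

-- Fix a root in each component and
-- a walk from the root base v of v's component to v, of colour potential v,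
-- and let Y v a = gap (base v) v (potential v) a.  The generators are Y v a
-- for the t = n − c non-roots v, together with the ≤ 2k cycle functionals.
module Generators (ℝ : RealNumbers) {n m : ℕ} (G : ColoredGraph n m) (d : Fin m → ℝ² ℝ) (c k : ℕ)
  (components : NumComponents G Sub.⊤ Sub.⊤ c) (rank : HasRank G Sub.⊤ k) where
  open RealFacts ℝ
  open Functionals ℝ n
  open Rows G d
  open ClosedWalks G
  open CycleFunctionals ℝ G

  component : Fin n → Fin c
  component v = proj₁ components v SubP.∈⊤

  root : Fin c → Fin n
  root j = proj₁ (proj₁ (proj₂ components) j)

  component-root : ∀ j → component (root j) ≡ j
  component-root j = P.trans (P.cong (proj₁ components (root j)) ([]=-irrelevant _ _))
                             (proj₂ (proj₂ (proj₁ (proj₂ components) j)))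

  same-component⇔walk : ∀ u v → (component u ≡ component v) ⇔ Walk G Sub.⊤ u v
  same-component⇔walk u v = proj₂ (proj₂ components) u SubP.∈⊤ v SubP.∈⊤

  root-injective : ∀ i j → root i ≡ root j → i ≡ j
  root-injective i j e = P.trans (P.sym (component-root i)) (P.trans (P.cong component e) (component-root j))

  base : Fin n → Fin n
  base v = root (component v)

  walkTo : ∀ v → Σ (List Step) (IsWalk (base v) v)
  walkTo v = walk→steps (Equivalence.to (same-component⇔walk (base v) v) (component-root (component v)))

  potential : Fin n → ℤ²
  potential v = walkColour (proj₁ (walkTo v))

  Y : Fin n → Fin 2 → V
  Y v = gap (base v) v (potential v)

  nonRoots : Complement root
  nonRoots = complement root root-injective

  cycles : CycleSpan k
  cycles = cycle-span k rank

  open Complement nonRoots public renaming (size to t; enum to σ; size-bound to t+c≤n)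
  open CycleSpan cycles public renaming (size to l; functionals to BL; size-bound to l≤2k)

  Y₀ Y₁ : Fin t → V
  Y₀ i = Y (σ i) Fin.zero
  Y₁ i = Y (σ i) (Fin.suc Fin.zero)

  generators : Fin ((t N.+ t) N.+ l) → V
  generators = (Y₀ ++ Y₁) ++ BL

  generator : ∀ {v w} j → generators j ≡ w → v ≋ w → Among generators v
  generator j j↦w v≋w = j , λ x → trans (v≋w x) (reflexive (P.cong (λ f → f x) (P.sym j↦w)))

  Y∈generators : ∀ i a → Among generators (Y (σ i) a)
  Y∈generators i Fin.zero = generator ((i ↑ˡ t) ↑ˡ l)
    (P.trans (lookup-++ˡ (Y₀ ++ Y₁) BL (i ↑ˡ t)) (lookup-++ˡ Y₀ Y₁ i)) (λ _ → refl)
  Y∈generators i (Fin.suc Fin.zero) = generator ((t ↑ʳ i) ↑ˡ l)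
    (P.trans (lookup-++ˡ (Y₀ ++ Y₁) BL (t ↑ʳ i)) (lookup-++ʳ Y₀ Y₁ i)) (λ _ → refl)

  Γ-in-span : ∀ h → Γ h → ∀ a → Span (Among generators) (matrixTimes h a)
  Γ-in-span h h∈Γ a = span-trans (λ v (j , v≋) → gen (generator ((t N.+ t) ↑ʳ j) (lookup-++ʳ (Y₀ ++ Y₁) BL j) v≋))
                                 (spans h h∈Γ a)

  -- Y v a is a generator when v is not a root; for a root v it is the gap of
  -- a closed walk, − (L potential v)_a, with potential v ∈ Γ.
  Y-in-span : ∀ v a → Span (Among generators) (Y v a)
  Y-in-span v a with covers v
  ... | inj₁ (i , σi≡v) = P.subst (λ w → Span (Among generators) (Y w a)) σi≡v (gen (Y∈generators i a))
  ... | inj₂ (j , rootj≡v) =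
    span-≋ (λ x → sym (P.subst (λ r → gap r v (potential v) a x ≈ (0V -V matrixTimes (potential v) a) x)
                               (P.sym base≡v) (gap-loop v (potential v) a x)))
           (span-- span-0 (Γ-in-span (potential v) potential∈Γ a))
    where
      base≡v : base v ≡ v
      base≡v = P.trans (P.cong base (P.sym rootj≡v)) (P.trans (P.cong root (component-root j)) rootj≡v)
      potential∈Γ : Γ (potential v)
      potential∈Γ = closed-walk∈Γ (proj₁ (walkTo v)) (walk-subst (proj₁ (walkTo v)) base≡v P.refl (proj₂ (walkTo v)))

  -- For an edge e : u → w the walk base → u → w → base closes up, so by
  -- gap-triangle the collapse functional of e is Y w a − Y u a − (L h)_a, h ∈ Γ.
  collapse-in-span : ∀ e a → Span (Among generators) (collapse e a)
  collapse-in-span e a = span-≋ (λ x → sym (gap-triangle r u w γ (potential u) (potential w) a x))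
    (span-- (span-- Yw-in-span (Y-in-span u a)) (Γ-in-span _ (P.subst Γ loop-colour loop∈Γ) a))
    where
      u w r : Fin n
      u = src G e
      w = tgt G e
      r = base u
      γ : ℤ²
      γ = col G e
      base≡ : base u ≡ base w
      base≡ = P.cong root (Equivalence.from (same-component⇔walk u w) ((e , true , SubP.∈⊤ , P.refl) ∷ []))
      Yw-in-span : Span (Among generators) (gap r w (potential w) a)
      Yw-in-span = P.subst (λ r′ → Span (Among generators) (gap r′ w (potential w) a)) (P.sym base≡) (Y-in-span w a)
      loop : List Step
      loop = proj₁ (walkTo u) ++ₗ ((e , true) ∷ reverse (proj₁ (walkTo w)))
      loop∈Γ : Γ (walkColour loop)
      loop∈Γ = closed-walk∈Γ loop (walk-subst loop P.refl (P.sym base≡)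
                 (walk-++ (proj₁ (walkTo u)) (proj₂ (walkTo u)) (P.refl , walk-reverse _ (proj₂ (walkTo w)))))
      loop-colour : walkColour loop ≡ potential u +² (γ +² (-² potential w))
      loop-colour = P.trans (walkColour-++ (proj₁ (walkTo u)) ((e , true) ∷ reverse (proj₁ (walkTo w))))
                            (P.cong (λ z → potential u +² (γ +² z)) (walkColour-reverse (proj₁ (walkTo w))))

  row-in-span : ∀ e → Span (Among generators) (coeff ℝ G d e)
  row-in-span e = span-≋ (λ x → sym (row-decomposition e x))
    (span-- span-0 (lin∈span (_⊥ ℝ (d e)) (collapse e) (collapse-in-span e)))

  generator-count : m N.+ 2 N.* c ≡ 2 N.* n N.+ 2 N.* k → (t N.+ t) N.+ l N.≤ m
  generator-count = generator-bound {t} {c} {n} {l} {k} {m} t+c≤n l≤2k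

lemma37 : (ℝ : RealNumbers) → ∀ {n m} (G : ColoredGraph n m) (c k : ℕ) →
    ColoredLamanCircuit G →
    NumComponents G Sub.⊤ Sub.⊤ c →
    HasRank G Sub.⊤ k →
    (+ m) ≡ ((+ 2) ℤ.* (+ n) ℤ.+ (+ 2) ℤ.* (+ k) ℤ.- (+ 2) ℤ.* (+ c)) →
    (d : Fin m → ℝ² ℝ) →
    (r : ℕ) → (+ r) ≡ ((+ 2) ℤ.* (+ n) ℤ.+ (+ 2) ℤ.* (+ k) ℤ.- (+ 2) ℤ.* (+ c)) →
    HasMatrixRank ℝ (coeff ℝ G d) r →
    (p : Fin n → ℝ² ℝ) (L : Mat2 ℝ) →
    IsSolution ℝ G d p L → IsCollapsed ℝ G d p L
lemma37 ℝ {n} {m} G c k _ components rank m≡ d r r≡ ((rows , _ , independent) , _) p L solution =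
  collapsed-if-gaps-vanish p L gaps-vanish
  where
    open RealFacts ℝ
    open Functionals ℝ n
    open Rows G d
    open Evaluation p L
    open Generators ℝ G d c k components rank

    R : Fin r → V
    R i = coeff ℝ G d (rows i)

    -- the r = m independent rows lie in the span of at most m generators,
    -- so by the exchange lemma the rows span the generators
    generators-in-row-span : ∀ j → Span (Among R) (generators j)
    generators-in-row-span = exchange-independent R generators independent (λ i → row-in-span (rows i))
      (P.subst ((t N.+ t) N.+ l N.≤_) (ZP.+-injective (P.trans m≡ (P.sym r≡)))
               (generator-count (edge-count m n k c m≡)))

    -- hence every collapse functional lies in the row space, where a solution vanishes
    gaps-vanish : ∀ e a → ev (collapse e a) ≈ 0#
    gaps-vanish e a = ev-span (λ φ (i , φ≋Ri) → trans (ev-cong φ≋Ri) (ev-row p L solution (rows i)))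
      (span-trans (λ φ (j , φ≋) → span-≋ (λ x → sym (φ≋ x)) (generators-in-row-span j)) (collapse-in-span e a))
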